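{- Let $q$ be a prime power, $n,k$ integers with $1<k<n-1$, $V=\mathbb{F}_q^n$, and let $m$ be an integer with $m(n,k)\le m\le k-2$ such that $n=[k-m]_q\cdot(q+1)+m$. Then there exist $X,Y\in\mathcal{C}(n,k)_q$ such that $d(X,Y)=k-m$ and $d_c(X,Y)=k-m+1$.
   Context: $\mathbb{F}_q$ is the finite field with $q$ elements. For $i=1,\dots,n$, $C_i=\{(x_1,\dots,x_n)\in V: x_i=0\}$. A non-degenerate linear $[n,k]_q$ code is a $k$-dimensional subspace of $V$ not contained in any $C_i$; $\mathcal{C}(n,k)_q$ is the set of all such codes. The Grassmann graph $\Gamma_k(V)$ has as vertices the $k$-dimensional subspaces of $V$, two adjacent iff their intersection is $(k-1)$-dimensional; its graph distance is $d(X,Y)=k-\dim(X\cap Y)$. $\Gamma(n,k)_q$ is the induced subgraph of $\Gamma_k(V)$ on $\mathcal{C}(n,k)_q$ (it is connected), and $d_c(X,Y)$ denotes the graph distance in $\Gamma(n,k)_q$. Notation: $[j]_q=\frac{q^j-1}{q-1}$ and $m(n,k)=k-\min\{k,n-k\}$. -}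

module Defs where

open import Data.Nat using (ℕ; zero; suc; _+_; _*_; _∸_; _^_; _⊓_; _≤_; _<_)
open import Data.Nat.Primality using (Prime)
open import Data.Fin using (Fin)
import Data.Fin as Fin
open import Data.Product using (Σ; ∃; _×_; _,_)
open import Relation.Binary.PropositionalEquality using (_≡_; _≢_)
open import Relation.Nullary using (¬_)
open import Function.Bundles using (_↔_)
open import Algebra.Structures using (IsCommutativeRing)
open import Level using (Lift; 0ℓ) renaming (suc to lsuc)

IsPrimePower : ℕ → Set
IsPrimePower q = Σ ℕ λ p → Σ ℕ λ e → Prime p × (1 ≤ e) × (q ≡ p ^ e)

record FiniteField (q : ℕ) : Set₁ where
  infixl 6 _⊕_
  infixl 7 _⊛_
  field
    Carrier : Set
    _⊕_ _⊛_ : Carrier → Carrier → Carrier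
    ⊝_      : Carrier → Carrier
    0# 1#   : Carrier
    isCommutativeRing : IsCommutativeRing _≡_ _⊕_ _⊛_ ⊝_ 0# 1#
    0≢1     : 0# ≢ 1#
    inverse : ∀ x → x ≢ 0# → Σ Carrier λ y → x ⊛ y ≡ 1#
    card    : Carrier ↔ Fin q

-- Gaussian-type integer [j]_q = (q^j - 1)/(q - 1) = 1 + q + ... + q^(j-1)
[_]_ : ℕ → ℕ → ℕ
[ zero ]  q = 0
[ suc j ] q = 1 + q * [ j ] q

mnk : ℕ → ℕ → ℕ
mnk n k = k ∸ (k ⊓ (n ∸ k))

module Space {q : ℕ} (F : FiniteField q) (n : ℕ) where
  open FiniteField F

  Vec : Set
  Vec = Fin n → Carrier

  _≋_ : Vec → Vec → Set
  u ≋ v = ∀ i → u i ≡ v i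

  0v : Vec
  0v _ = 0#

  _+v_ : Vec → Vec → Vec
  (u +v v) i = u i ⊕ v i

  _·v_ : Carrier → Vec → Vec
  (c ·v v) i = c ⊛ v i

  lc : (j : ℕ) → (Fin j → Carrier) → (Fin j → Vec) → Vec
  lc zero    c b = 0v
  lc (suc j) c b = (c Fin.zero ·v b Fin.zero) +v lc j (λ i → c (Fin.suc i)) (λ i → b (Fin.suc i))

  LinIndep : (j : ℕ) → (Fin j → Vec) → Set
  LinIndep j b = ∀ c → lc j c b ≋ 0v → ∀ i → c i ≡ 0#

  Sub : Set₁
  Sub = Vec → Set

  _∩_ : Sub → Sub → Sub
  (X ∩ Y) v = X v × Y v

  HasDim : Sub → ℕ → Set
  HasDim W j = Σ (Fin j → Vec) λ b → LinIndep j b ×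
                 (∀ v → (W v → Σ (Fin j → Carrier) λ c → v ≋ lc j c b)
                      × (Σ (Fin j → Carrier) (λ c → v ≋ lc j c b) → W v))

  ⊆C : Sub → Fin n → Set
  ⊆C X i = ∀ v → X v → v i ≡ 0#

  IsCode : ℕ → Sub → Set
  IsCode k X = HasDim X k × (∀ i → ¬ ⊆C X i)

  Dist : ℕ → Sub → Sub → ℕ → Set
  Dist k X Y d = Σ ℕ λ j → HasDim (X ∩ Y) j × (d ≡ k ∸ j)

  Adj : ℕ → Sub → Sub → Set
  Adj k X Y = HasDim (X ∩ Y) (k ∸ 1)

  SameSub : Sub → Sub → Set
  SameSub X Y = ∀ v → (X v → Y v) × (Y v → X v)

  Walk : ℕ → ℕ → Sub → Sub → Set₁
  Walk k zero    X Y = Lift (lsuc 0ℓ) (SameSub X Y)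
  Walk k (suc ℓ) X Y = Σ Sub λ Z → IsCode k Z × Adj k X Z × Walk k ℓ Z Y

  DistC : ℕ → Sub → Sub → ℕ → Set₁
  DistC k X Y d = Walk k d X Y × (∀ ℓ → ℓ < d → ¬ Walk k ℓ X Y)

-- Put t = k − m. The coordinates of F_q^n are q + 1 copies of every point p of
-- PG(t-1, q) and m extra coordinates. X is spanned by the t coordinate rows of the
-- point columns and by the unit vectors μ r of the extra coordinates; Y arises from X
-- by replacing the q + 1 copies of each p by the q + 1 points of a line through p.
-- Then X ∩ Y = ⟨μ⟩, so d(X, Y) = t, and exchanging the generators one at a time,
-- starting with the all-ones vector, is a walk of length t + 1 through codes.
-- On a walk of length t the first code Z is adjacent to X and at distance t − 1
-- from Y, which forces X ∩ Z to be a hyperplane of X containing ⟨μ⟩, hence the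
-- kernel of a point p. Then Z = (X ∩ Z) + ⟨y⟩ with y ∈ Y, and as every linear form
-- vanishes on some point of the line through p, Z vanishes on one of the
-- coordinates of p: Z is degenerate.
module Submission where

open import Defs
open import Data.Nat as ℕ using (ℕ; zero; suc; _+_; _*_; _∸_; _≤_; _<_; s≤s; z≤n)
import Data.Nat.Properties as ℕ
open import Data.Integer as ℤ using (ℤ; +_; -[1+_])
import Data.Integer.Properties as ℤ
open import Data.Sign as Sign using (Sign)
open import Data.Fin as Fin using (Fin; zero; suc; punchIn; _↑ˡ_; _↑ʳ_; splitAt; combine; remQuot; toℕ)
import Data.Fin.Properties as Fin
open import Data.Vec.Functional using (_∷_; _++_; insertAt)
open import Data.Vec.Functional.Properties using (insertAt-lookup; insertAt-punchIn)
open import Data.Product using (Σ; _×_; _,_; proj₁; proj₂)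
open import Data.Sum using (_⊎_; inj₁; inj₂) renaming ([_,_] to [_,_]′)
open import Data.Maybe using (Maybe; nothing; just)
open import Data.Empty using (⊥-elim)
open import Relation.Nullary using (¬_; Dec; yes; no; ¬?)
open import Relation.Nullary.Decidable using (decidable-stable)
open import Relation.Binary.Definitions using (Decidable)
open import Relation.Binary.PropositionalEquality hiding ([_])
open import Function using (_∘_)
open import Function.Definitions using (Injective)
open import Function.Bundles using (Inverse)
open import Algebra.Bundles using (CommutativeRing)
open import Algebra.Solver.Ring.AlmostCommutativeRing
  using (AlmostCommutativeRing; fromCommutativeRing; _-Raw-AlmostCommutative⟶_)
import Level

module FieldProperties {q : ℕ} (F : FiniteField q) where
  open FiniteField F public
  open Inverse card public using ()
    renaming (to to toFin; from to fromFin; strictlyInverseʳ to fromFin-toFin)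

  commutativeRing : CommutativeRing Level.zero Level.zero
  commutativeRing = record { isCommutativeRing = isCommutativeRing }

  open CommutativeRing commutativeRing public
    using ( +-assoc; +-comm; *-assoc; *-comm; +-identityˡ; +-identityʳ; *-identityˡ; *-identityʳ
          ; distribˡ; distribʳ; -‿inverseʳ; zeroˡ; zeroʳ; ring; semiring)
  open import Algebra.Properties.Ring ring public
    using (-‿involutive; -‿distribˡ-*; -‿distribʳ-*; -0#≈0#; -‿anti-homo-+)
  open import Algebra.Properties.Semiring.Sum semiring public
    using (sum; sum-cong-≗; sum-replicate-zero; sum-remove; ∑-distrib-+; ∑-comm; *-distribˡ-sum; *-distribʳ-sum)
  open import Algebra.Properties.Semiring.Mult.TCOptimised semiring
    using (×-homo-+; ×1-homo-*) renaming (_×_ to _⨰_)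

  _≟_ : Decidable {A = Carrier} _≡_
  x ≟ y with toFin x Fin.≟ toFin y
  ... | yes e = yes (trans (sym (fromFin-toFin x)) (trans (cong fromFin e) (fromFin-toFin y)))
  ... | no ne = no (λ e → ne (cong toFin e))

  1≢0 : 1# ≢ 0#
  1≢0 e = 0≢1 (sym e)

  -- The ring solver needs coefficients whose equality computes, so we use ℤ
  -- via the canonical homomorphism ℤ → F.
  ⟦_⟧ℤ : ℤ → Carrier
  ⟦ + n ⟧ℤ     = n ⨰ 1#
  ⟦ -[1+ n ] ⟧ℤ = ⊝ (suc n ⨰ 1#)

  ×1-suc : ∀ n → suc n ⨰ 1# ≡ 1# ⊕ n ⨰ 1#
  ×1-suc n = ×-homo-+ 1# 1 n

  ⊝-distrib-⊕ : ∀ a b → ⊝ (a ⊕ b) ≡ ⊝ a ⊕ ⊝ b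
  ⊝-distrib-⊕ a b = trans (-‿anti-homo-+ a b) (+-comm _ _)

  ⟦⊖⟧ : ∀ m n → ⟦ m ℤ.⊖ n ⟧ℤ ≡ m ⨰ 1# ⊕ ⊝ (n ⨰ 1#)
  ⟦⊖⟧ zero    zero    = sym (trans (cong (0# ⊕_) -0#≈0#) (+-identityʳ _))
  ⟦⊖⟧ zero    (suc n) = sym (+-identityˡ _)
  ⟦⊖⟧ (suc m) zero    = sym (trans (cong (suc m ⨰ 1# ⊕_) -0#≈0#) (+-identityʳ _))
  ⟦⊖⟧ (suc m) (suc n) = begin
    ⟦ suc m ℤ.⊖ suc n ⟧ℤ                    ≡⟨ cong ⟦_⟧ℤ (ℤ.[1+m]⊖[1+n]≡m⊖n m n) ⟩
    ⟦ m ℤ.⊖ n ⟧ℤ                            ≡⟨ ⟦⊖⟧ m n ⟩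
    M ⊕ ⊝ N                                 ≡⟨ cancel ⟩
    (1# ⊕ M) ⊕ ⊝ (1# ⊕ N)                   ≡⟨ sym (cong₂ (λ a b → a ⊕ ⊝ b) (×1-suc m) (×1-suc n)) ⟩
    suc m ⨰ 1# ⊕ ⊝ (suc n ⨰ 1#)             ∎
    where
    open ≡-Reasoning
    M = m ⨰ 1#
    N = n ⨰ 1#
    cancel : M ⊕ ⊝ N ≡ (1# ⊕ M) ⊕ ⊝ (1# ⊕ N)
    cancel = begin
      M ⊕ ⊝ N                       ≡⟨ cong (_⊕ ⊝ N) (sym (+-identityˡ M)) ⟩
      (0# ⊕ M) ⊕ ⊝ N                ≡⟨ cong (λ z → (z ⊕ M) ⊕ ⊝ N) (sym (-‿inverseʳ 1#)) ⟩
      ((1# ⊕ ⊝ 1#) ⊕ M) ⊕ ⊝ N       ≡⟨ cong (_⊕ ⊝ N) (trans (+-assoc _ _ _) (trans (cong (1# ⊕_) (+-comm _ _)) (sym (+-assoc _ _ _)))) ⟩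
      ((1# ⊕ M) ⊕ ⊝ 1#) ⊕ ⊝ N       ≡⟨ +-assoc _ _ _ ⟩
      (1# ⊕ M) ⊕ (⊝ 1# ⊕ ⊝ N)       ≡⟨ cong ((1# ⊕ M) ⊕_) (sym (⊝-distrib-⊕ 1# N)) ⟩
      (1# ⊕ M) ⊕ ⊝ (1# ⊕ N)         ∎

  ⟦+⟧ : ∀ a b → ⟦ a ℤ.+ b ⟧ℤ ≡ ⟦ a ⟧ℤ ⊕ ⟦ b ⟧ℤ
  ⟦+⟧ -[1+ m ] -[1+ n ] = begin
    ⊝ (suc (suc (m + n)) ⨰ 1#)          ≡⟨ cong (λ z → ⊝ (suc z ⨰ 1#)) (ℕ.+-suc m n) ⟨
    ⊝ ((suc m + suc n) ⨰ 1#)            ≡⟨ cong ⊝_ (×-homo-+ 1# (suc m) (suc n)) ⟩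
    ⊝ (suc m ⨰ 1# ⊕ suc n ⨰ 1#)         ≡⟨ ⊝-distrib-⊕ _ _ ⟩
    ⊝ (suc m ⨰ 1#) ⊕ ⊝ (suc n ⨰ 1#)     ∎
    where open ≡-Reasoning
  ⟦+⟧ -[1+ m ] (+ n)    = trans (⟦⊖⟧ n (suc m)) (+-comm _ _)
  ⟦+⟧ (+ m)    -[1+ n ] = ⟦⊖⟧ m (suc n)
  ⟦+⟧ (+ m)    (+ n)    = ×-homo-+ 1# m n

  signed : Sign → Carrier → Carrier
  signed Sign.+ x = x
  signed Sign.- x = ⊝ x

  signed-* : ∀ s t x y → signed (s Sign.* t) (x ⊛ y) ≡ signed s x ⊛ signed t y
  signed-* Sign.+ Sign.+ x y = refl
  signed-* Sign.+ Sign.- x y = -‿distribʳ-* x y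
  signed-* Sign.- Sign.+ x y = -‿distribˡ-* x y
  signed-* Sign.- Sign.- x y = begin
    x ⊛ y         ≡⟨ -‿involutive _ ⟨
    ⊝ ⊝ (x ⊛ y)   ≡⟨ cong ⊝_ (-‿distribʳ-* x y) ⟩
    ⊝ (x ⊛ ⊝ y)   ≡⟨ -‿distribˡ-* x (⊝ y) ⟩
    ⊝ x ⊛ ⊝ y     ∎
    where open ≡-Reasoning

  ⟦◃⟧ : ∀ s n → ⟦ s ℤ.◃ n ⟧ℤ ≡ signed s (n ⨰ 1#)
  ⟦◃⟧ Sign.+ zero    = refl
  ⟦◃⟧ Sign.- zero    = sym -0#≈0#
  ⟦◃⟧ Sign.+ (suc n) = refl
  ⟦◃⟧ Sign.- (suc n) = refl

  ⟦⟧-signAbs : ∀ i → ⟦ i ⟧ℤ ≡ signed (ℤ.sign i) (ℤ.∣ i ∣ ⨰ 1#)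
  ⟦⟧-signAbs (+ n)     = refl
  ⟦⟧-signAbs -[1+ n ] = refl

  ⟦*⟧ : ∀ a b → ⟦ a ℤ.* b ⟧ℤ ≡ ⟦ a ⟧ℤ ⊛ ⟦ b ⟧ℤ
  ⟦*⟧ a b = begin
    ⟦ a ℤ.* b ⟧ℤ                                              ≡⟨ ⟦◃⟧ (ℤ.sign a Sign.* ℤ.sign b) (ℤ.∣ a ∣ * ℤ.∣ b ∣) ⟩
    signed (ℤ.sign a Sign.* ℤ.sign b) ((ℤ.∣ a ∣ * ℤ.∣ b ∣) ⨰ 1#)
      ≡⟨ cong (signed (ℤ.sign a Sign.* ℤ.sign b)) (×1-homo-* ℤ.∣ a ∣ ℤ.∣ b ∣) ⟩
    signed (ℤ.sign a Sign.* ℤ.sign b) ((ℤ.∣ a ∣ ⨰ 1#) ⊛ (ℤ.∣ b ∣ ⨰ 1#))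
      ≡⟨ signed-* (ℤ.sign a) (ℤ.sign b) _ _ ⟩
    signed (ℤ.sign a) (ℤ.∣ a ∣ ⨰ 1#) ⊛ signed (ℤ.sign b) (ℤ.∣ b ∣ ⨰ 1#)
      ≡⟨ sym (cong₂ _⊛_ (⟦⟧-signAbs a) (⟦⟧-signAbs b)) ⟩
    ⟦ a ⟧ℤ ⊛ ⟦ b ⟧ℤ                                            ∎
    where open ≡-Reasoning

  ⟦-⟧ : ∀ a → ⟦ ℤ.- a ⟧ℤ ≡ ⊝ ⟦ a ⟧ℤ
  ⟦-⟧ (+ zero)  = sym -0#≈0#
  ⟦-⟧ (+ suc n) = refl
  ⟦-⟧ -[1+ n ]  = sym (-‿involutive _)

  almostCommutativeRing : AlmostCommutativeRing Level.zero Level.zero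
  almostCommutativeRing = fromCommutativeRing commutativeRing

  ℤ-homomorphism : ℤ.+-*-rawRing -Raw-AlmostCommutative⟶ almostCommutativeRing
  ℤ-homomorphism = record
    { ⟦_⟧ = ⟦_⟧ℤ ; +-homo = ⟦+⟧ ; *-homo = ⟦*⟧ ; -‿homo = ⟦-⟧ ; 0-homo = refl ; 1-homo = refl }

  ⟦⟧-equal? : ∀ a b → Maybe (⟦ a ⟧ℤ ≡ ⟦ b ⟧ℤ)
  ⟦⟧-equal? a b with a ℤ.≟ b
  ... | yes refl = just refl
  ... | no _     = nothing

  open import Algebra.Solver.Ring ℤ.+-*-rawRing almostCommutativeRing ℤ-homomorphism ⟦⟧-equal? public
    using (solve; _:=_; _:+_; _:*_; :-_; _:-_; con)

  inv : ∀ x → x ≢ 0# → Carrier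
  inv x x≢0 = proj₁ (inverse x x≢0)

  *-inverseʳ : ∀ x (x≢0 : x ≢ 0#) → x ⊛ inv x x≢0 ≡ 1#
  *-inverseʳ x x≢0 = proj₂ (inverse x x≢0)

  *-inverseˡ : ∀ x (x≢0 : x ≢ 0#) → inv x x≢0 ⊛ x ≡ 1#
  *-inverseˡ x x≢0 = trans (*-comm _ _) (*-inverseʳ x x≢0)

  *-cancelˡ-zero : ∀ a x → a ≢ 0# → a ⊛ x ≡ 0# → x ≡ 0#
  *-cancelˡ-zero a x a≢0 ax≡0 = begin
    x                      ≡⟨ *-identityˡ x ⟨
    1# ⊛ x                 ≡⟨ cong (_⊛ x) (*-inverseˡ a a≢0) ⟨
    (inv a a≢0 ⊛ a) ⊛ x    ≡⟨ *-assoc _ _ _ ⟩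
    inv a a≢0 ⊛ (a ⊛ x)    ≡⟨ cong (inv a a≢0 ⊛_) ax≡0 ⟩
    inv a a≢0 ⊛ 0#         ≡⟨ zeroʳ _ ⟩
    0#                     ∎
    where open ≡-Reasoning

  *-nonzero : ∀ {a b} → a ≢ 0# → b ≢ 0# → a ⊛ b ≢ 0#
  *-nonzero {a} {b} a≢0 b≢0 ab≡0 = b≢0 (*-cancelˡ-zero a b a≢0 ab≡0)

  +≡0⇒≡- : ∀ a b → a ⊕ b ≡ 0# → a ≡ ⊝ b
  +≡0⇒≡- a b a+b≡0 = begin
    a                ≡⟨ solve 2 (λ a b → a := (a :+ b) :- b) refl a b ⟩
    (a ⊕ b) ⊕ ⊝ b    ≡⟨ cong (_⊕ ⊝ b) a+b≡0 ⟩
    0# ⊕ ⊝ b         ≡⟨ +-identityˡ _ ⟩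
    ⊝ b              ∎
    where open ≡-Reasoning

  zero-or-nonzero : ∀ {j} (f : Fin j → Carrier) → (∀ i → f i ≡ 0#) ⊎ Σ (Fin j) λ i → f i ≢ 0#
  zero-or-nonzero f with Fin.any? (λ i → ¬? (f i ≟ 0#))
  ... | yes nonzero = inj₂ nonzero
  ... | no ¬nonzero = inj₁ λ i → decidable-stable (f i ≟ 0#) (λ fᵢ≢0 → ¬nonzero (i , fᵢ≢0))

  ∑-zero : ∀ {j} (f : Fin j → Carrier) → (∀ i → f i ≡ 0#) → sum f ≡ 0#
  ∑-zero {j} f f≗0 = trans (sum-cong-≗ f≗0) (sum-replicate-zero j)

  ∑-single : ∀ {j} (i : Fin j) (f : Fin j → Carrier) → (∀ l → l ≢ i → f l ≡ 0#) → sum f ≡ f i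
  ∑-single {suc j} i f others≡0 = begin
    sum f                                ≡⟨ sum-remove {i = i} f ⟩
    f i ⊕ sum (f ∘ punchIn i)            ≡⟨ cong (f i ⊕_) (∑-zero _ (λ l → others≡0 _ (Fin.punchInᵢ≢i i l))) ⟩
    f i ⊕ 0#                             ≡⟨ +-identityʳ _ ⟩
    f i                                  ∎
    where open ≡-Reasoning

  ∑-++ : ∀ a b (g : Fin (a + b) → Carrier) → sum g ≡ sum (g ∘ (_↑ˡ b)) ⊕ sum (g ∘ (a ↑ʳ_))
  ∑-++ zero    b g = sym (+-identityˡ _)
  ∑-++ (suc a) b g = trans (cong (g zero ⊕_) (∑-++ a b (g ∘ suc))) (sym (+-assoc _ _ _))

  ∑-insertAt : ∀ {a} (x : Fin a → Carrier) (i : Fin (suc a)) κ (g : Fin (suc a) → Carrier) →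
               sum (λ j → insertAt x i κ j ⊛ g j) ≡ κ ⊛ g i ⊕ sum (λ j → x j ⊛ g (punchIn i j))
  ∑-insertAt x i κ g = trans (sum-remove {i = i} (λ j → insertAt x i κ j ⊛ g j)) (cong₂ _⊕_
    (cong (_⊛ g i) (insertAt-lookup x i κ))
    (sum-cong-≗ (λ j → cong (_⊛ g (punchIn i j)) (insertAt-punchIn x i κ j))))

module HomogeneousSystems {q : ℕ} (F : FiniteField q) where
  open FieldProperties F

  Solves : ∀ {a b} → (Fin a → Fin b → Carrier) → (Fin a → Carrier) → Set
  Solves A x = ∀ l → sum (λ i → x i ⊛ A i l) ≡ 0#

  module Elimination {a b} (A : Fin (suc a) → Fin (suc b) → Carrier) (i₀ : Fin (suc a)) (pivot≢0 : A i₀ zero ≢ 0#) where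
    c : Fin (suc a) → Carrier
    c i = A i zero

    r : Carrier
    r = inv (c i₀) pivot≢0

    reduced : Fin a → Fin b → Carrier
    reduced i l = A (punchIn i₀ i) (suc l) ⊕ ⊝ ((c (punchIn i₀ i) ⊛ r) ⊛ A i₀ (suc l))

    back-substitute : (Fin a → Carrier) → Fin (suc a) → Carrier
    back-substitute x = insertAt x i₀ (⊝ (sum (λ i → x i ⊛ c (punchIn i₀ i)) ⊛ r))

    back-substitute-solves : ∀ x → Solves reduced x → Solves A (back-substitute x)
    back-substitute-solves x x-solves = solves
      where
      S = sum (λ i → x i ⊛ c (punchIn i₀ i))
      open ≡-Reasoning
      remaining : ∀ l → sum (λ i → x i ⊛ A (punchIn i₀ i) (suc l)) ≡ S ⊛ r ⊛ A i₀ (suc l)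
      remaining l = begin
        sum (λ i → x i ⊛ A (punchIn i₀ i) (suc l))
          ≡⟨ sum-cong-≗ (λ i → solve 5 (λ X a y z w → X :* a := X :* (a :- (y :* z) :* w) :+ (X :* y) :* (z :* w))
                                       refl (x i) (A (punchIn i₀ i) (suc l)) (c (punchIn i₀ i)) r (A i₀ (suc l))) ⟩
        sum (λ i → x i ⊛ reduced i l ⊕ (x i ⊛ c (punchIn i₀ i)) ⊛ (r ⊛ A i₀ (suc l)))
          ≡⟨ ∑-distrib-+ (λ i → x i ⊛ reduced i l) (λ i → (x i ⊛ c (punchIn i₀ i)) ⊛ (r ⊛ A i₀ (suc l))) ⟩
        sum (λ i → x i ⊛ reduced i l) ⊕ sum (λ i → (x i ⊛ c (punchIn i₀ i)) ⊛ (r ⊛ A i₀ (suc l)))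
          ≡⟨ cong₂ _⊕_ (x-solves l) (sym (*-distribʳ-sum (r ⊛ A i₀ (suc l)) (λ i → x i ⊛ c (punchIn i₀ i)))) ⟩
        0# ⊕ S ⊛ (r ⊛ A i₀ (suc l))
          ≡⟨ solve 3 (λ S r y → con (+ 0) :+ S :* (r :* y) := S :* r :* y) refl S r (A i₀ (suc l)) ⟩
        S ⊛ r ⊛ A i₀ (suc l) ∎
      solves : Solves A (back-substitute x)
      solves zero = begin
        sum (λ i → back-substitute x i ⊛ c i)     ≡⟨ ∑-insertAt x i₀ _ c ⟩
        ⊝ (S ⊛ r) ⊛ c i₀ ⊕ S                      ≡⟨ solve 3 (λ S r p → (:- (S :* r)) :* p :+ S := S :* (con (+ 1) :- r :* p)) refl S r (c i₀) ⟩
        S ⊛ (1# ⊕ ⊝ (r ⊛ c i₀))                   ≡⟨ cong (λ z → S ⊛ (1# ⊕ ⊝ z)) (*-inverseˡ (c i₀) pivot≢0) ⟩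
        S ⊛ (1# ⊕ ⊝ 1#)                           ≡⟨ solve 1 (λ S → S :* (con (+ 1) :- con (+ 1)) := con (+ 0)) refl S ⟩
        0#                                        ∎
      solves (suc l) = begin
        sum (λ i → back-substitute x i ⊛ A i (suc l))   ≡⟨ ∑-insertAt x i₀ _ (λ i → A i (suc l)) ⟩
        ⊝ (S ⊛ r) ⊛ A i₀ (suc l) ⊕ sum (λ i → x i ⊛ A (punchIn i₀ i) (suc l))
          ≡⟨ cong (⊝ (S ⊛ r) ⊛ A i₀ (suc l) ⊕_) (remaining l) ⟩
        ⊝ (S ⊛ r) ⊛ A i₀ (suc l) ⊕ S ⊛ r ⊛ A i₀ (suc l)
          ≡⟨ solve 3 (λ S r y → (:- (S :* r)) :* y :+ S :* r :* y := con (+ 0)) refl S r (A i₀ (suc l)) ⟩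
        0#                                              ∎

  nontrivial-solution : ∀ b a → b < a → (A : Fin a → Fin b → Carrier) →
    Σ (Fin a → Carrier) λ x → (Σ (Fin a) λ i → x i ≢ 0#) × Solves A x
  nontrivial-solution zero (suc a) _ A = (1# ∷ λ _ → 0#) , (zero , 1≢0) , λ ()
  nontrivial-solution (suc b) (suc a) (s≤s b<a) A with zero-or-nonzero (λ i → A i zero)
  ... | inj₁ column₀≡0 = x , x≢0 , solves
    where
    rest = nontrivial-solution b (suc a) (ℕ.m<n⇒m<1+n b<a) (λ i l → A i (suc l))
    x = proj₁ rest
    x≢0 = proj₁ (proj₂ rest)
    solves : Solves A x
    solves zero    = ∑-zero _ (λ i → trans (cong (x i ⊛_) (column₀≡0 i)) (zeroʳ _))
    solves (suc l) = proj₂ (proj₂ rest) l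
  ... | inj₂ (i₀ , pivot≢0) = back-substitute x , (punchIn i₀ j , x≢0) , back-substitute-solves x (proj₂ (proj₂ rest))
    where
    open Elimination A i₀ pivot≢0
    rest = nontrivial-solution b a b<a reduced
    x = proj₁ rest
    j = proj₁ (proj₁ (proj₂ rest))
    x≢0 : back-substitute x (punchIn i₀ j) ≢ 0#
    x≢0 e = proj₂ (proj₁ (proj₂ rest)) (trans (sym (insertAt-punchIn x i₀ _ j)) e)

module LinearAlgebra {q : ℕ} (F : FiniteField q) (n : ℕ) where
  open FieldProperties F public
  open HomogeneousSystems F
  open Space F n public

  lc≡∑ : ∀ j c b x → lc j c b x ≡ sum (λ i → c i ⊛ b i x)
  lc≡∑ zero    c b x = refl
  lc≡∑ (suc j) c b x = cong (c zero ⊛ b zero x ⊕_) (lc≡∑ j (c ∘ suc) (b ∘ suc) x)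

  lc-cong : ∀ j {c c' : Fin j → Carrier} b → (∀ i → c i ≡ c' i) → lc j c b ≋ lc j c' b
  lc-cong j b c≗c' x = trans (lc≡∑ j _ b x) (trans (sum-cong-≗ (λ i → cong (_⊛ b i x) (c≗c' i))) (sym (lc≡∑ j _ b x)))

  ∑-lc : ∀ a c (y : Fin a → Carrier) (C : Fin a → Fin c → Carrier) (b : Fin c → Vec) x →
         sum (λ i → y i ⊛ lc c (C i) b x) ≡ lc c (λ l → sum (λ i → y i ⊛ C i l)) b x
  ∑-lc a c y C b x = begin
    sum (λ i → y i ⊛ lc c (C i) b x)
      ≡⟨ sum-cong-≗ (λ i → trans (cong (y i ⊛_) (lc≡∑ c (C i) b x)) (*-distribˡ-sum (y i) (λ l → C i l ⊛ b l x))) ⟩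
    sum (λ i → sum (λ l → y i ⊛ (C i l ⊛ b l x)))          ≡⟨ ∑-comm (λ i l → y i ⊛ (C i l ⊛ b l x)) ⟩
    sum (λ l → sum (λ i → y i ⊛ (C i l ⊛ b l x)))
      ≡⟨ sum-cong-≗ (λ l → trans (sum-cong-≗ (λ i → sym (*-assoc (y i) (C i l) (b l x)))) (sym (*-distribʳ-sum (b l x) (λ i → y i ⊛ C i l)))) ⟩
    sum (λ l → sum (λ i → y i ⊛ C i l) ⊛ b l x)           ≡⟨ lc≡∑ c _ b x ⟨
    lc c (λ l → sum (λ i → y i ⊛ C i l)) b x              ∎
    where open ≡-Reasoning

  InSpan : (j : ℕ) → (Fin j → Vec) → Sub
  InSpan j b v = Σ (Fin j → Carrier) λ c → v ≋ lc j c b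

  δ : ∀ {j} → Fin j → Fin j → Carrier
  δ i l with l Fin.≟ i
  ... | yes _ = 1#
  ... | no _  = 0#

  δ-same : ∀ {j} (i : Fin j) → δ i i ≡ 1#
  δ-same i with i Fin.≟ i
  ... | yes _ = refl
  ... | no i≢i = ⊥-elim (i≢i refl)

  δ-diff : ∀ {j} (i l : Fin j) → l ≢ i → δ i l ≡ 0#
  δ-diff i l l≢i with l Fin.≟ i
  ... | yes l≡i = ⊥-elim (l≢i l≡i)
  ... | no _    = refl

  span-generator : ∀ j b i → InSpan j b (b i)
  span-generator j b i = δ i , λ x → sym (begin
    lc j (δ i) b x                   ≡⟨ lc≡∑ j _ b x ⟩
    sum (λ l → δ i l ⊛ b l x)        ≡⟨ ∑-single i _ (λ l l≢i → trans (cong (_⊛ b l x) (δ-diff i l l≢i)) (zeroˡ _)) ⟩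
    δ i i ⊛ b i x                    ≡⟨ trans (cong (_⊛ b i x) (δ-same i)) (*-identityˡ _) ⟩
    b i x                            ∎)
    where open ≡-Reasoning

  span-resp-≋ : ∀ j b {u v} → u ≋ v → InSpan j b u → InSpan j b v
  span-resp-≋ j b u≋v (c , u≋lc) = c , λ x → trans (sym (u≋v x)) (u≋lc x)

  span-lc : ∀ j b a (u : Fin a → Vec) y → (∀ i → InSpan j b (u i)) → InSpan j b (lc a y u)
  span-lc j b a u y u∈ = _ , λ x →
    trans (lc≡∑ a y u x) (trans (sum-cong-≗ (λ i → cong (y i ⊛_) (proj₂ (u∈ i) x))) (∑-lc a j y (λ i → proj₁ (u∈ i)) b x))

  span-+ : ∀ j b {u v} → InSpan j b u → InSpan j b v → InSpan j b (u +v v)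
  span-+ j b {u} {v} (c , u≋) (c' , v≋) = (λ i → c i ⊕ c' i) , λ x → begin
    u x ⊕ v x                                        ≡⟨ cong₂ _⊕_ (trans (u≋ x) (lc≡∑ j c b x)) (trans (v≋ x) (lc≡∑ j c' b x)) ⟩
    sum (λ i → c i ⊛ b i x) ⊕ sum (λ i → c' i ⊛ b i x) ≡⟨ ∑-distrib-+ (λ i → c i ⊛ b i x) (λ i → c' i ⊛ b i x) ⟨
    sum (λ i → c i ⊛ b i x ⊕ c' i ⊛ b i x)            ≡⟨ sum-cong-≗ (λ i → sym (distribʳ (b i x) (c i) (c' i))) ⟩
    sum (λ i → (c i ⊕ c' i) ⊛ b i x)                 ≡⟨ lc≡∑ j _ b x ⟨
    lc j (λ i → c i ⊕ c' i) b x                      ∎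
    where open ≡-Reasoning

  span-· : ∀ j b a {u} → InSpan j b u → InSpan j b (a ·v u)
  span-· j b a {u} (c , u≋) = (λ i → a ⊛ c i) , λ x → begin
    a ⊛ u x                            ≡⟨ cong (a ⊛_) (trans (u≋ x) (lc≡∑ j c b x)) ⟩
    a ⊛ sum (λ i → c i ⊛ b i x)        ≡⟨ *-distribˡ-sum a (λ i → c i ⊛ b i x) ⟩
    sum (λ i → a ⊛ (c i ⊛ b i x))      ≡⟨ sum-cong-≗ (λ i → sym (*-assoc a (c i) (b i x))) ⟩
    sum (λ i → (a ⊛ c i) ⊛ b i x)      ≡⟨ lc≡∑ j _ b x ⟨
    lc j (λ i → a ⊛ c i) b x           ∎
    where open ≡-Reasoning

  span-vanishes : ∀ a (b : Fin a → Vec) x → (∀ i → b i x ≡ 0#) → ∀ {v} → InSpan a b v → v x ≡ 0#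
  span-vanishes a b x b≡0 (c , v≋) =
    trans (v≋ x) (trans (lc≡∑ a c b x) (∑-zero _ (λ i → trans (cong (c i ⊛_) (b≡0 i)) (zeroʳ _))))

  lc-drop : ∀ r (i₀ : Fin (suc r)) c (g : Fin (suc r) → Vec) → c i₀ ≡ 0# →
            lc (suc r) c g ≋ lc r (c ∘ punchIn i₀) (g ∘ punchIn i₀)
  lc-drop r i₀ c g cᵢ₀≡0 x = begin
    lc (suc r) c g x                                       ≡⟨ lc≡∑ (suc r) c g x ⟩
    sum (λ i → c i ⊛ g i x)                                ≡⟨ sum-remove {i = i₀} (λ i → c i ⊛ g i x) ⟩
    c i₀ ⊛ g i₀ x ⊕ sum (λ j → c (punchIn i₀ j) ⊛ g (punchIn i₀ j) x)
      ≡⟨ cong (_⊕ sum (λ j → c (punchIn i₀ j) ⊛ g (punchIn i₀ j) x)) (trans (cong (_⊛ g i₀ x) cᵢ₀≡0) (zeroˡ _)) ⟩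
    0# ⊕ sum (λ j → c (punchIn i₀ j) ⊛ g (punchIn i₀ j) x)  ≡⟨ +-identityˡ _ ⟩
    sum (λ j → c (punchIn i₀ j) ⊛ g (punchIn i₀ j) x)       ≡⟨ lc≡∑ r _ _ x ⟨
    lc r (c ∘ punchIn i₀) (g ∘ punchIn i₀) x               ∎
    where open ≡-Reasoning

  lc-insert-zero : ∀ r (i₀ : Fin (suc r)) d (g : Fin (suc r) → Vec) →
                   lc (suc r) (insertAt d i₀ 0#) g ≋ lc r d (g ∘ punchIn i₀)
  lc-insert-zero r i₀ d g x = trans (lc-drop r i₀ (insertAt d i₀ 0#) g (insertAt-lookup d i₀ 0#) x)
                                    (lc-cong r (g ∘ punchIn i₀) (insertAt-punchIn d i₀ 0#) x)

  independent-in-span⇒≤ : ∀ a c (u : Fin a → Vec) (b : Fin c → Vec) →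
                          LinIndep a u → (∀ i → InSpan c b (u i)) → a ≤ c
  independent-in-span⇒≤ a c u b u-indep u∈ with c ℕ.<? a
  ... | no c≮a = ℕ.≮⇒≥ c≮a
  ... | yes c<a = ⊥-elim (proj₂ (proj₁ (proj₂ solution)) (u-indep y combination≡0 (proj₁ (proj₁ (proj₂ solution)))))
    where
    C : Fin a → Fin c → Carrier
    C i = proj₁ (u∈ i)
    solution = nontrivial-solution c a c<a C
    y = proj₁ solution
    combination≡0 : lc a y u ≋ 0v
    combination≡0 x = begin
      lc a y u x                                 ≡⟨ lc≡∑ a y u x ⟩
      sum (λ i → y i ⊛ u i x)                    ≡⟨ sum-cong-≗ (λ i → cong (y i ⊛_) (proj₂ (u∈ i) x)) ⟩
      sum (λ i → y i ⊛ lc c (C i) b x)           ≡⟨ ∑-lc a c y C b x ⟩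
      lc c (λ l → sum (λ i → y i ⊛ C i l)) b x   ≡⟨ lc-cong c b (proj₂ (proj₂ solution)) x ⟩
      lc c (λ _ → 0#) b x                        ≡⟨ trans (lc≡∑ c _ b x) (∑-zero _ (λ l → zeroˡ (b l x))) ⟩
      0#                                         ∎
      where open ≡-Reasoning

  independent-∷ : ∀ a (u : Fin a → Vec) v → LinIndep a u → ¬ InSpan a u v → LinIndep (suc a) (v ∷ u)
  independent-∷ a u v u-indep v∉ c combination≡0 = coefficient≡0
    where
    S : Fin n → Carrier
    S x = lc a (c ∘ suc) u x
    c₀≡0 : c zero ≡ 0#
    c₀≡0 with c zero ≟ 0#
    ... | yes c₀≡0 = c₀≡0
    ... | no c₀≢0 = ⊥-elim (v∉ (d , v≋))
      where
      r = inv (c zero) c₀≢0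
      d : Fin a → Carrier
      d i = ⊝ (r ⊛ c (suc i))
      v≋ : v ≋ lc a d u
      v≋ x = begin
        v x                                  ≡⟨ *-identityˡ _ ⟨
        1# ⊛ v x                             ≡⟨ cong (_⊛ v x) (*-inverseˡ (c zero) c₀≢0) ⟨
        (r ⊛ c zero) ⊛ v x                   ≡⟨ *-assoc _ _ _ ⟩
        r ⊛ (c zero ⊛ v x)                   ≡⟨ cong (r ⊛_) (+≡0⇒≡- _ _ (combination≡0 x)) ⟩
        r ⊛ ⊝ S x                            ≡⟨ cong (λ z → r ⊛ ⊝ z) (lc≡∑ a _ u x) ⟩
        r ⊛ ⊝ sum (λ i → c (suc i) ⊛ u i x)  ≡⟨ solve 2 (λ r s → r :* (:- s) := (:- r) :* s) refl r _ ⟩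
        ⊝ r ⊛ sum (λ i → c (suc i) ⊛ u i x)  ≡⟨ *-distribˡ-sum (⊝ r) (λ i → c (suc i) ⊛ u i x) ⟩
        sum (λ i → ⊝ r ⊛ (c (suc i) ⊛ u i x))
          ≡⟨ sum-cong-≗ (λ i → solve 3 (λ r c w → (:- r) :* (c :* w) := (:- (r :* c)) :* w) refl r (c (suc i)) (u i x)) ⟩
        sum (λ i → d i ⊛ u i x)              ≡⟨ lc≡∑ a d u x ⟨
        lc a d u x                           ∎
        where open ≡-Reasoning
    tail≡0 : lc a (c ∘ suc) u ≋ 0v
    tail≡0 x = trans (sym (+-identityˡ _)) (trans (cong (_⊕ S x) (sym (trans (cong (_⊛ v x) c₀≡0) (zeroˡ _)))) (combination≡0 x))
    coefficient≡0 : ∀ i → c i ≡ 0#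
    coefficient≡0 zero    = c₀≡0
    coefficient≡0 (suc i) = u-indep _ tail≡0 i

  -- By exhaustive search over the q ^ j coefficient vectors.
  ∃-coefficients? : ∀ j (P : (Fin j → Carrier) → Set) → (∀ c c' → (∀ i → c i ≡ c' i) → P c → P c') →
                    (∀ c → Dec (P c)) → Dec (Σ _ P)
  ∃-coefficients? zero P resp P? with P? (λ ())
  ... | yes p = yes (_ , p)
  ... | no ¬p = no (λ (c , pc) → ¬p (resp c _ (λ ()) pc))
  ∃-coefficients? (suc j) P resp P?
    with Fin.any? (λ i → ∃-coefficients? j (λ c' → P (fromFin i ∷ c'))
                            (λ c c' c≗c' → resp _ _ (λ { zero → refl ; (suc l) → c≗c' l }))
                            (λ c' → P? _))
  ... | yes (i , c' , p) = yes (_ , p)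
  ... | no none = no λ (c , pc) → none (toFin (c zero) , c ∘ suc ,
          resp c _ (λ { zero → sym (fromFin-toFin (c zero)) ; (suc l) → refl }) pc)

  InSpan? : ∀ j b v → Dec (InSpan j b v)
  InSpan? j b v = ∃-coefficients? j (λ c → v ≋ lc j c b)
    (λ c c' c≗c' v≋ x → trans (v≋ x) (lc-cong j b c≗c' x))
    (λ c → Fin.all? (λ x → v x ≟ lc j c b x))

  module _ {W : Sub} {j : ℕ} (W-dim : HasDim W j) where
    basis : Fin j → Vec
    basis = proj₁ W-dim

    basis-independent : LinIndep j basis
    basis-independent = proj₁ (proj₂ W-dim)

    toSpan : ∀ {v} → W v → InSpan j basis v
    toSpan {v} = proj₁ (proj₂ (proj₂ W-dim) v)

    fromSpan : ∀ {v} → InSpan j basis v → W v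
    fromSpan {v} = proj₂ (proj₂ (proj₂ W-dim) v)

    basis∈ : ∀ i → W (basis i)
    basis∈ i = fromSpan (span-generator j basis i)

    ∈-resp-≋ : ∀ {u v} → u ≋ v → W u → W v
    ∈-resp-≋ u≋v = fromSpan ∘ span-resp-≋ j basis u≋v ∘ toSpan

    ∈-+ : ∀ {u v} → W u → W v → W (u +v v)
    ∈-+ u∈ v∈ = fromSpan (span-+ j basis (toSpan u∈) (toSpan v∈))

    ∈-· : ∀ a {u} → W u → W (a ·v u)
    ∈-· a = fromSpan ∘ span-· j basis a ∘ toSpan

    span⊆ : ∀ {a} (u : Fin a → Vec) → (∀ i → W (u i)) → ∀ {v} → InSpan a u v → W v
    span⊆ {a} u u∈ (c , v≋) = fromSpan (span-resp-≋ j basis (λ x → sym (v≋ x)) (span-lc j basis a u c (toSpan ∘ u∈)))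

    ∈-lc : ∀ a (u : Fin a → Vec) c → (∀ i → W (u i)) → W (lc a c u)
    ∈-lc a u c u∈ = span⊆ u u∈ (c , λ x → refl)

    independent⇒≤dim : ∀ {a} (u : Fin a → Vec) → LinIndep a u → (∀ i → W (u i)) → a ≤ j
    independent⇒≤dim {a} u u-indep u∈ = independent-in-span⇒≤ a j u basis u-indep (toSpan ∘ u∈)

  record Complement (Z W : Sub) : Set₁ where
    field
      z₀    : Vec
      z₀∈Z  : Z z₀
      z₀∉W  : ¬ W z₀
      split : ∀ {z} → Z z → Σ Vec λ w → Σ Carrier λ a → W w × (z ≋ (w +v (a ·v z₀)))

  hyperplane-complement : ∀ r {Z W : Sub} → HasDim Z (suc r) → HasDim W r → (∀ {v} → W v → Z v) → Complement Z W
  hyperplane-complement r {Z} {W} Z-dim W-dim W⊆Z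
    with Fin.all? (λ i → InSpan? r (basis W-dim) (basis Z-dim i))
  ... | yes all∈W = ⊥-elim (ℕ.n≮n r (independent-in-span⇒≤ (suc r) r (basis Z-dim) (basis W-dim) (basis-independent Z-dim) all∈W))
  ... | no ¬all∈W = record
    { z₀ = basis Z-dim i ; z₀∈Z = basis∈ Z-dim i ; z₀∉W = z₀∉W ∘ toSpan W-dim ; split = split }
    where
    witness = Fin.¬∀⟶∃¬ (suc r) _ (λ i → InSpan? r (basis W-dim) (basis Z-dim i)) ¬all∈W
    i = proj₁ witness
    z₀∉W = proj₂ witness
    z₀ = basis Z-dim i
    split : ∀ {z} → Z z → Σ Vec λ w → Σ Carrier λ a → W w × (z ≋ (w +v (a ·v z₀)))
    split {z} z∈Z with InSpan? (suc r) (z₀ ∷ basis W-dim) z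
    ... | yes (c , z≋) = lc r (c ∘ suc) (basis W-dim) , c zero , ∈-lc W-dim r _ _ (basis∈ W-dim) ,
                         λ x → trans (z≋ x) (+-comm _ _)
    ... | no z∉ = ⊥-elim (ℕ.n≮n (suc r) (independent⇒≤dim Z-dim (z ∷ (z₀ ∷ basis W-dim)) independent ∈Z))
      where
      independent = independent-∷ (suc r) (z₀ ∷ basis W-dim) z
        (independent-∷ r (basis W-dim) z₀ (basis-independent W-dim) z₀∉W) z∉
      ∈Z : ∀ l → Z ((z ∷ (z₀ ∷ basis W-dim)) l)
      ∈Z zero          = z∈Z
      ∈Z (suc zero)    = basis∈ Z-dim i
      ∈Z (suc (suc l)) = W⊆Z (basis∈ W-dim l)

  -- Writing u i = h i + α i z₀ with h i ∈ W, the vectors u i + β i u i₀ lie in W once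
  -- z₀ has been eliminated against a pivot α i₀ ≠ 0.
  module IntoHyperplane {r a} {Z W : Sub} (W-dim : HasDim W r) (C : Complement Z W)
                        (u : Fin (suc a) → Vec) (u-indep : LinIndep (suc a) u) (u∈Z : ∀ i → Z (u i)) where
    open Complement C

    h : Fin (suc a) → Vec
    h i = proj₁ (split (u∈Z i))

    α : Fin (suc a) → Carrier
    α i = proj₁ (proj₂ (split (u∈Z i)))

    h∈W : ∀ i → W (h i)
    h∈W i = proj₁ (proj₂ (proj₂ (split (u∈Z i))))

    u≋ : ∀ i → u i ≋ (h i +v (α i ·v z₀))
    u≋ i = proj₂ (proj₂ (proj₂ (split (u∈Z i))))

    Result : Set
    Result = Σ (Fin a → Vec) λ w → LinIndep a w × (∀ i → W (w i)) × (∀ i → InSpan (suc a) u (w i))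

    all-in-W : (∀ i → α i ≡ 0#) → Result
    all-in-W α≡0 = u ∘ suc , tail-independent , tail∈W , span-generator (suc a) u ∘ suc
      where
      tail-independent : LinIndep a (u ∘ suc)
      tail-independent c c≡0 i = u-indep (0# ∷ c) (λ x → trans (cong (_⊕ lc a c (u ∘ suc) x) (zeroˡ _))
                                                              (trans (+-identityˡ _) (c≡0 x))) (suc i)
      tail∈W : ∀ i → W (u (suc i))
      tail∈W i = ∈-resp-≋ W-dim (λ x → sym (begin
        u (suc i) x                        ≡⟨ u≋ (suc i) x ⟩
        h (suc i) x ⊕ α (suc i) ⊛ z₀ x     ≡⟨ cong (λ a → h (suc i) x ⊕ a ⊛ z₀ x) (α≡0 (suc i)) ⟩
        h (suc i) x ⊕ 0# ⊛ z₀ x            ≡⟨ trans (cong (h (suc i) x ⊕_) (zeroˡ _)) (+-identityʳ _) ⟩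
        h (suc i) x                        ∎)) (h∈W (suc i))
        where open ≡-Reasoning

    module _ (i₀ : Fin (suc a)) (α₀≢0 : α i₀ ≢ 0#) where
      ρ : Carrier
      ρ = inv (α i₀) α₀≢0

      β : Fin a → Carrier
      β j = ⊝ (α (punchIn i₀ j) ⊛ ρ)

      w : Fin a → Vec
      w j = u (punchIn i₀ j) +v (β j ·v u i₀)

      w∈W : ∀ j → W (w j)
      w∈W j = ∈-resp-≋ W-dim w≋ (∈-+ W-dim (h∈W p) (∈-· W-dim (β j) (h∈W i₀)))
        where
        p = punchIn i₀ j
        w≋ : (h p +v (β j ·v h i₀)) ≋ w j
        w≋ x = sym (begin
          u p x ⊕ β j ⊛ u i₀ x                                          ≡⟨ cong₂ (λ s t → s ⊕ β j ⊛ t) (u≋ p x) (u≋ i₀ x) ⟩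
          (h p x ⊕ α p ⊛ z₀ x) ⊕ ⊝ (α p ⊛ ρ) ⊛ (h i₀ x ⊕ α i₀ ⊛ z₀ x)
            ≡⟨ solve 6 (λ hp ap z b h₀ a₀ → (hp :+ ap :* z) :+ (:- (ap :* b)) :* (h₀ :+ a₀ :* z)
                                            := (hp :+ (:- (ap :* b)) :* h₀) :+ (ap :* z) :* (con (+ 1) :- b :* a₀))
                       refl (h p x) (α p) (z₀ x) ρ (h i₀ x) (α i₀) ⟩
          (h p x ⊕ β j ⊛ h i₀ x) ⊕ (α p ⊛ z₀ x) ⊛ (1# ⊕ ⊝ (ρ ⊛ α i₀))
            ≡⟨ cong (λ t → (h p x ⊕ β j ⊛ h i₀ x) ⊕ (α p ⊛ z₀ x) ⊛ (1# ⊕ ⊝ t)) (*-inverseˡ (α i₀) α₀≢0) ⟩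
          (h p x ⊕ β j ⊛ h i₀ x) ⊕ (α p ⊛ z₀ x) ⊛ (1# ⊕ ⊝ 1#)
            ≡⟨ solve 2 (λ s t → s :+ t :* (con (+ 1) :- con (+ 1)) := s) refl (h p x ⊕ β j ⊛ h i₀ x) (α p ⊛ z₀ x) ⟩
          h p x ⊕ β j ⊛ h i₀ x                                          ∎)
          where open ≡-Reasoning

      w-independent : LinIndep a w
      w-independent c c≡0 j = trans (sym (insertAt-punchIn c i₀ κ j)) (u-indep y y≡0 (punchIn i₀ j))
        where
        κ = sum (λ j → c j ⊛ β j)
        y = insertAt c i₀ κ
        y≡0 : lc (suc a) y u ≋ 0v
        y≡0 x = begin
          lc (suc a) y u x                                                   ≡⟨ lc≡∑ (suc a) y u x ⟩
          sum (λ i → y i ⊛ u i x)                                            ≡⟨ ∑-insertAt c i₀ κ (λ i → u i x) ⟩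
          κ ⊛ u i₀ x ⊕ sum (λ j → c j ⊛ u (punchIn i₀ j) x)                 ≡⟨ +-comm _ _ ⟩
          sum (λ j → c j ⊛ u (punchIn i₀ j) x) ⊕ κ ⊛ u i₀ x
            ≡⟨ cong (sum (λ j → c j ⊛ u (punchIn i₀ j) x) ⊕_) (*-distribʳ-sum (u i₀ x) (λ j → c j ⊛ β j)) ⟩
          sum (λ j → c j ⊛ u (punchIn i₀ j) x) ⊕ sum (λ j → (c j ⊛ β j) ⊛ u i₀ x)
            ≡⟨ ∑-distrib-+ (λ j → c j ⊛ u (punchIn i₀ j) x) (λ j → (c j ⊛ β j) ⊛ u i₀ x) ⟨
          sum (λ j → c j ⊛ u (punchIn i₀ j) x ⊕ (c j ⊛ β j) ⊛ u i₀ x)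
            ≡⟨ sum-cong-≗ (λ j → solve 4 (λ c up b u₀ → c :* up :+ (c :* b) :* u₀ := c :* (up :+ b :* u₀))
                                         refl (c j) (u (punchIn i₀ j) x) (β j) (u i₀ x)) ⟩
          sum (λ j → c j ⊛ w j x)                                            ≡⟨ lc≡∑ a c w x ⟨
          lc a c w x                                                         ≡⟨ c≡0 x ⟩
          0#                                                                 ∎
          where open ≡-Reasoning

      eliminated : Result
      eliminated = w , w-independent , w∈W , λ j →
        span-+ (suc a) u (span-generator (suc a) u (punchIn i₀ j)) (span-· (suc a) u (β j) (span-generator (suc a) u i₀))

  independent-into-hyperplane : ∀ r a {Z W : Sub} → HasDim Z (suc r) → HasDim W r → (∀ {v} → W v → Z v) →
    (u : Fin a → Vec) → LinIndep a u → (∀ i → Z (u i)) →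
    Σ (Fin (a ∸ 1) → Vec) λ w → LinIndep (a ∸ 1) w × (∀ i → W (w i)) × (∀ i → InSpan a u (w i))
  independent-into-hyperplane r zero    Z-dim W-dim W⊆Z u u-indep u∈Z = (λ ()) , (λ c e ()) , (λ ()) , (λ ())
  independent-into-hyperplane r (suc a) Z-dim W-dim W⊆Z u u-indep u∈Z =
    [ all-in-W , (λ (i₀ , α₀≢0) → eliminated i₀ α₀≢0) ]′ (zero-or-nonzero α)
    where open IntoHyperplane W-dim (hyperplane-complement r Z-dim W-dim W⊆Z) u u-indep u∈Z

  independent-in-span-spans : ∀ a (b w : Fin a → Vec) → LinIndep a w → (∀ i → InSpan a b (w i)) → ∀ r → InSpan a w (b r)
  independent-in-span-spans a b w w-indep w∈ r with InSpan? a w (b r)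
  ... | yes bᵣ∈ = bᵣ∈
  ... | no bᵣ∉ = ⊥-elim (ℕ.n≮n a (independent-in-span⇒≤ (suc a) a (b r ∷ w) b (independent-∷ a w (b r) w-indep bᵣ∉) ∈b))
    where
    ∈b : ∀ i → InSpan a b ((b r ∷ w) i)
    ∈b zero    = span-generator a b r
    ∈b (suc i) = w∈ i

  complement-unique : ∀ {Z W : Sub} {j} → HasDim W j → (C : Complement Z W) →
    ∀ {h g} a → W h → W g → h ≋ (g +v (a ·v Complement.z₀ C)) → a ≡ 0#
  complement-unique {W = W} W-dim C {h} {g} a h∈W g∈W h≋ with a ≟ 0#
  ... | yes a≡0 = a≡0
  ... | no a≢0 = ⊥-elim (z₀∉W (∈-resp-≋ W-dim z₀≋ (∈-· W-dim (inv a a≢0) (∈-+ W-dim h∈W (∈-· W-dim (⊝ 1#) g∈W)))))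
    where
    open Complement C
    z₀≋ : (inv a a≢0 ·v (h +v ((⊝ 1#) ·v g))) ≋ z₀
    z₀≋ x = begin
      inv a a≢0 ⊛ (h x ⊕ ⊝ 1# ⊛ g x)              ≡⟨ cong (λ z → inv a a≢0 ⊛ (z ⊕ ⊝ 1# ⊛ g x)) (h≋ x) ⟩
      inv a a≢0 ⊛ ((g x ⊕ a ⊛ z₀ x) ⊕ ⊝ 1# ⊛ g x)  ≡⟨ solve 4 (λ i g a z → i :* ((g :+ a :* z) :+ (:- con (+ 1)) :* g) := (i :* a) :* z)
                                                          refl (inv a a≢0) (g x) a (z₀ x) ⟩
      (inv a a≢0 ⊛ a) ⊛ z₀ x                       ≡⟨ trans (cong (_⊛ z₀ x) (*-inverseˡ a a≢0)) (*-identityˡ _) ⟩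
      z₀ x                                         ∎
      where open ≡-Reasoning

  hyperplane-vanishing : ∀ r {Z H : Sub} → HasDim Z (suc r) → HasDim H r → (∀ {v} → H v → Z v) →
    ∀ {y} → Z y → ¬ H y → ∀ x → y x ≡ 0# → (∀ {h} → H h → h x ≡ 0#) → ∀ {z} → Z z → z x ≡ 0#
  hyperplane-vanishing r {Z} {H} Z-dim H-dim H⊆Z {y} y∈Z y∉H x yₓ≡0 H-vanishes {z} z∈Z with z x ≟ 0#
  ... | yes zₓ≡0 = zₓ≡0
  ... | no zₓ≢0 = ⊥-elim (ℕ.n≮n (suc r) (independent⇒≤dim Z-dim (z ∷ (y ∷ basis H-dim)) independent ∈Z))
    where
    vanish : ∀ i → (y ∷ basis H-dim) i x ≡ 0#
    vanish zero    = yₓ≡0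
    vanish (suc i) = H-vanishes (basis∈ H-dim i)
    independent = independent-∷ (suc r) (y ∷ basis H-dim) z
      (independent-∷ r (basis H-dim) y (basis-independent H-dim) (y∉H ∘ fromSpan H-dim))
      (zₓ≢0 ∘ span-vanishes (suc r) (y ∷ basis H-dim) x vanish)
    ∈Z : ∀ i → Z ((z ∷ (y ∷ basis H-dim)) i)
    ∈Z zero          = z∈Z
    ∈Z (suc zero)    = y∈Z
    ∈Z (suc (suc i)) = H⊆Z (basis∈ H-dim i)

  CommonIndependent : Sub → Sub → ℕ → Set
  CommonIndependent X Y a = Σ (Fin a → Vec) λ u → LinIndep a u × (∀ i → X (u i)) × (∀ i → Y (u i))

  -- Each step of a walk in the Grassmann graph loses at most one dimension of the
  -- intersection with the endpoint, i.e. d(Z, Y) ≤ ℓ.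
  walk⇒common-independent : ∀ r ℓ {Z Y : Sub} → HasDim Z (suc r) → HasDim Y (suc r) →
                            Walk (suc r) ℓ Z Y → CommonIndependent Z Y (suc r ∸ ℓ)
  walk⇒common-independent r zero Z-dim Y-dim (Level.lift Z≈Y) =
    basis Z-dim , basis-independent Z-dim , basis∈ Z-dim , λ i → proj₁ (Z≈Y _) (basis∈ Z-dim i)
  walk⇒common-independent r (suc ℓ) {Z} {Y} Z-dim Y-dim (Z' , (Z'-dim , _) , Z~Z' , walk)
    with walk⇒common-independent r ℓ Z'-dim Y-dim walk
  ... | u , u-indep , u∈Z' , u∈Y
    with independent-into-hyperplane r (suc r ∸ ℓ) Z'-dim Z~Z' proj₂ u u-indep u∈Z'
  ... | w , w-indep , w∈Z∩Z' , w∈span =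
    subst (CommonIndependent Z Y) (trans (ℕ.∸-+-assoc (suc r) ℓ 1) (cong (suc r ∸_) (ℕ.+-comm ℓ 1)))
      (w , w-indep , proj₁ ∘ w∈Z∩Z' , span⊆ Y-dim u u∈Y ∘ w∈span)

-- The [ t ] q points of the projective space PG(t-1, q), each represented by the
-- coordinate vector whose first non-zero entry is 1: index 0 is (1, 0, …, 0) and
-- index 1 + (c, p) is (c, point p).
module ProjectivePoints {q : ℕ} (F : FiniteField q) where
  open FieldProperties F

  point : ∀ t → Fin ([ t ] q) → Fin t → Carrier
  point (suc t) zero    zero    = 1#
  point (suc t) zero    (suc _) = 0#
  point (suc t) (suc i) zero    = fromFin (proj₁ (remQuot {q} ([ t ] q) i))
  point (suc t) (suc i) (suc s) = point t (proj₂ (remQuot {q} ([ t ] q) i)) s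

  extend : ∀ t → Carrier → Fin ([ t ] q) → Fin ([ suc t ] q)
  extend t x p = suc (combine (toFin x) p)

  point-extend-zero : ∀ t x p → point (suc t) (extend t x p) zero ≡ x
  point-extend-zero t x p = trans (cong (fromFin ∘ proj₁) (Fin.remQuot-combine (toFin x) p)) (fromFin-toFin x)

  point-extend-suc : ∀ t x p s → point (suc t) (extend t x p) (suc s) ≡ point t p s
  point-extend-suc t x p s = cong (λ z → point t (proj₂ z) s) (Fin.remQuot-combine (toFin x) p)

  unit : ∀ t → Fin t → Fin ([ t ] q)
  unit (suc t) zero    = zero
  unit (suc t) (suc s) = extend t 0# (unit t s)

  point-unit-same : ∀ t s → point t (unit t s) s ≡ 1#
  point-unit-same (suc t) zero    = refl
  point-unit-same (suc t) (suc s) = trans (point-extend-suc t 0# (unit t s) s) (point-unit-same t s)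

  point-unit-diff : ∀ t s s' → s' ≢ s → point t (unit t s) s' ≡ 0#
  point-unit-diff (suc t) zero    zero     s'≢s = ⊥-elim (s'≢s refl)
  point-unit-diff (suc t) zero    (suc s') s'≢s = refl
  point-unit-diff (suc t) (suc s) zero     s'≢s = point-extend-zero t 0# (unit t s)
  point-unit-diff (suc t) (suc s) (suc s') s'≢s =
    trans (point-extend-suc t 0# (unit t s) s') (point-unit-diff t s s' (s'≢s ∘ cong suc))

  point-nonzero : ∀ t p → Σ (Fin t) λ s → point t p s ≢ 0#
  point-nonzero (suc t) zero    = zero , 1≢0
  point-nonzero (suc t) (suc i) = suc (proj₁ rest) , proj₂ rest
    where rest = point-nonzero t (proj₂ (remQuot {q} ([ t ] q) i))

  proportional-to-point : ∀ t (a : Fin t → Carrier) → Σ (Fin t) (λ s → a s ≢ 0#) →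
    Σ (Fin ([ t ] q)) λ p → Σ Carrier λ λ₀ → λ₀ ≢ 0# × (∀ s → a s ≡ λ₀ ⊛ point t p s)
  proportional-to-point (suc t) a (s₀ , aₛ≢0) with zero-or-nonzero (a ∘ suc)
  ... | inj₁ tail≡0 = zero , a zero , a₀≢0 s₀ aₛ≢0 , proportional
    where
    a₀≢0 : ∀ s → a s ≢ 0# → a zero ≢ 0#
    a₀≢0 zero    aₛ≢0 = aₛ≢0
    a₀≢0 (suc s) aₛ≢0 = ⊥-elim (aₛ≢0 (tail≡0 s))
    proportional : ∀ s → a s ≡ a zero ⊛ point (suc t) zero s
    proportional zero    = sym (*-identityʳ _)
    proportional (suc s) = trans (tail≡0 s) (sym (zeroʳ _))
  ... | inj₂ tail≢0 = extend t α p , λ₀ , λ₀≢0 , proportional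
    where
    rest = proportional-to-point t (a ∘ suc) tail≢0
    p = proj₁ rest
    λ₀ = proj₁ (proj₂ rest)
    λ₀≢0 = proj₁ (proj₂ (proj₂ rest))
    α = a zero ⊛ inv λ₀ λ₀≢0
    proportional : ∀ s → a s ≡ λ₀ ⊛ point (suc t) (extend t α p) s
    proportional zero = sym (begin
      λ₀ ⊛ point (suc t) (extend t α p) zero   ≡⟨ cong (λ₀ ⊛_) (point-extend-zero t α p) ⟩
      λ₀ ⊛ (a zero ⊛ inv λ₀ λ₀≢0)            ≡⟨ solve 3 (λ l a i → l :* (a :* i) := a :* (i :* l)) refl λ₀ (a zero) (inv λ₀ λ₀≢0) ⟩
      a zero ⊛ (inv λ₀ λ₀≢0 ⊛ λ₀)            ≡⟨ trans (cong (a zero ⊛_) (*-inverseˡ λ₀ λ₀≢0)) (*-identityʳ _) ⟩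
      a zero                                 ∎)
      where open ≡-Reasoning
    proportional (suc s) = trans (proj₂ (proj₂ (proj₂ rest)) s) (sym (cong (λ₀ ⊛_) (point-extend-suc t α p s)))

module Construction {q : ℕ} (F : FiniteField q) (s m : ℕ) where
  open ProjectivePoints F

  t : ℕ
  t = suc (suc s)

  P : ℕ
  P = [ t ] q

  N : ℕ
  N = P * (q + 1)

  n : ℕ
  n = N + m

  k : ℕ
  k = t + m

  open LinearAlgebra F n public

  -- Coordinates: a block of q + 1 columns for every point p of PG(t-1, q), then m extra ones.
  column : Fin P → Fin (q + 1) → Fin n
  column p j = combine p j ↑ˡ m

  extra : Fin m → Fin n
  extra r = N ↑ʳ r

  finite : Carrier → Fin (q + 1)
  finite c = toFin c ↑ˡ 1

  ∞ : Fin (q + 1)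
  ∞ = q ↑ʳ zero

  off : Fin P → Fin t → Carrier
  off zero    (suc zero) = 1#
  off zero    _          = 0#
  off (suc _) zero       = 1#
  off (suc _) (suc _)    = 0#

  -- The q + 1 points off p + c·p (c ∈ F) and p of the line through p and off p,
  -- which is a line because off p is never proportional to p.
  line : Fin P → Fin (q + 1) → Fin t → Carrier
  line p j s' = [ (λ c → off p s' ⊕ fromFin c ⊛ point t p s') , (λ _ → point t p s') ]′ (splitAt q j)

  line-finite : ∀ p c s' → line p (finite c) s' ≡ off p s' ⊕ c ⊛ point t p s'
  line-finite p c s' rewrite Fin.splitAt-↑ˡ q (toFin c) 1 = cong (λ z → off p s' ⊕ z ⊛ point t p s') (fromFin-toFin c)

  line-∞ : ∀ p s' → line p ∞ s' ≡ point t p s'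
  line-∞ p s' rewrite Fin.splitAt-↑ʳ q 1 zero = refl

  data Tag : Set where
    μ     : Fin m → Tag
    ξ η   : Fin t → Tag
    ζ     : Tag

  columnValue : Tag → Fin P → Fin (q + 1) → Carrier
  columnValue (μ _)  p j = 0#
  columnValue (ξ s') p j = point t p s'
  columnValue (η s') p j = line p j s'
  columnValue ζ      p j = 1#

  extraValue : Tag → Fin m → Carrier
  extraValue (μ r) r' = δ r r'
  extraValue _     _  = 0#

  vec : Tag → Vec
  vec T = (λ y → columnValue T (proj₁ (remQuot {P} (q + 1) y)) (proj₂ (remQuot {P} (q + 1) y))) ++ extraValue T

  vec-column : ∀ T p j → vec T (column p j) ≡ columnValue T p j
  vec-column T p j rewrite Fin.splitAt-↑ˡ N (combine p j) m =
    cong (λ z → columnValue T (proj₁ z) (proj₂ z)) (Fin.remQuot-combine {P} {q + 1} p j)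

  vec-extra : ∀ T r → vec T (extra r) ≡ extraValue T r
  vec-extra T r rewrite Fin.splitAt-↑ʳ N m r = refl

  -- Linear forms are kept as syntax so that their linearity is proved once.
  infixl 6 _⊞_
  infix  7 ⊟_

  data Form : Set where
    coord : Fin n → Form
    _⊞_   : Form → Form → Form
    ⊟_    : Form → Form

  ⟪_⟫ : Form → Vec → Carrier
  ⟪ coord x ⟫ v = v x
  ⟪ φ ⊞ ψ ⟫   v = ⟪ φ ⟫ v ⊕ ⟪ ψ ⟫ v
  ⟪ ⊟ φ ⟫     v = ⊝ ⟪ φ ⟫ v

  form-resp-≋ : ∀ φ {u v} → u ≋ v → ⟪ φ ⟫ u ≡ ⟪ φ ⟫ v
  form-resp-≋ (coord x) u≋v = u≋v x
  form-resp-≋ (φ ⊞ ψ)   u≋v = cong₂ _⊕_ (form-resp-≋ φ u≋v) (form-resp-≋ ψ u≋v)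
  form-resp-≋ (⊟ φ)     u≋v = cong ⊝_ (form-resp-≋ φ u≋v)

  form-0 : ∀ φ → ⟪ φ ⟫ 0v ≡ 0#
  form-0 (coord x) = refl
  form-0 (φ ⊞ ψ)   = trans (cong₂ _⊕_ (form-0 φ) (form-0 ψ)) (+-identityʳ _)
  form-0 (⊟ φ)     = trans (cong ⊝_ (form-0 φ)) -0#≈0#

  form-+· : ∀ φ a u v → ⟪ φ ⟫ ((a ·v u) +v v) ≡ a ⊛ ⟪ φ ⟫ u ⊕ ⟪ φ ⟫ v
  form-+· (coord x) a u v = refl
  form-+· (φ ⊞ ψ)   a u v = trans (cong₂ _⊕_ (form-+· φ a u v) (form-+· ψ a u v))
    (solve 5 (λ a x y z w → (a :* x :+ y) :+ (a :* z :+ w) := a :* (x :+ z) :+ (y :+ w)) refl a _ _ _ _)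
  form-+· (⊟ φ)     a u v = trans (cong ⊝_ (form-+· φ a u v))
    (solve 3 (λ a x y → :- (a :* x :+ y) := a :* (:- x) :+ (:- y)) refl a _ _)

  form-lc : ∀ φ j c b → ⟪ φ ⟫ (lc j c b) ≡ sum (λ i → c i ⊛ ⟪ φ ⟫ (b i))
  form-lc φ zero    c b = form-0 φ
  form-lc φ (suc j) c b = trans (form-+· φ (c zero) (b zero) _) (cong (c zero ⊛ ⟪ φ ⟫ (b zero) ⊕_) (form-lc φ j (c ∘ suc) (b ∘ suc)))

  e₀ e₁ e₀₁ : Fin P
  e₀  = unit t zero
  e₁  = unit t (suc zero)
  e₀₁ = extend (suc s) 1# (unit (suc s) zero)

  point-e₀₁ : ∀ s' → point t e₀₁ s' ≡ point t e₀ s' ⊕ point t e₁ s'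
  point-e₀₁ zero     = trans (point-extend-zero (suc s) 1# _)
    (sym (trans (cong (1# ⊕_) (point-extend-zero (suc s) 0# (unit (suc s) zero))) (+-identityʳ _)))
  point-e₀₁ (suc s') = trans (point-extend-suc (suc s) 1# _ s')
    (sym (trans (cong (0# ⊕_) (point-extend-suc (suc s) 0# (unit (suc s) zero) s')) (+-identityˡ _)))

  -- Forms dual to the vectors vec T. ηForm s' takes the difference of two line
  -- columns over the unit point, which only sees the coefficient of p in off p + c·p;
  -- ζForm vanishes on every vector whose ∞-columns depend linearly on the point
  -- (as e₀₁ = e₀ + e₁), so of all generators it only sees the constant ζ.
  ηForm ξForm : Fin t → Form
  ζForm : Form
  ηForm s' = coord (column (unit t s') (finite 1#)) ⊞ ⊟ coord (column (unit t s') (finite 0#))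
  ζForm    = (coord (column e₀ ∞) ⊞ coord (column e₁ ∞)) ⊞ ⊟ coord (column e₀₁ ∞)
  ξForm s' = (coord (column (unit t s') ∞) ⊞ ⊟ ηForm s') ⊞ ⊟ ζForm

  dual : Tag → Form
  dual (μ r)  = coord (extra r)
  dual (ξ s') = ξForm s'
  dual (η s') = ηForm s'
  dual ζ      = ζForm

  ηForm-value : ∀ s' T → ⟪ ηForm s' ⟫ (vec T) ≡ columnValue T (unit t s') (finite 1#) ⊕ ⊝ columnValue T (unit t s') (finite 0#)
  ηForm-value s' T = cong₂ (λ a b → a ⊕ ⊝ b) (vec-column T _ _) (vec-column T _ _)

  ηForm-constant : ∀ s' T → (∀ p j j' → columnValue T p j ≡ columnValue T p j') → ⟪ ηForm s' ⟫ (vec T) ≡ 0#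
  ηForm-constant s' T constant = trans (ηForm-value s' T)
    (trans (cong (λ z → columnValue T (unit t s') (finite 1#) ⊕ ⊝ z) (constant _ _ _)) (-‿inverseʳ _))

  ηForm-η : ∀ s' s'' → ⟪ ηForm s' ⟫ (vec (η s'')) ≡ point t (unit t s') s''
  ηForm-η s' s'' = trans (ηForm-value s' (η s''))
    (trans (cong₂ (λ a b → a ⊕ ⊝ b) (line-finite (unit t s') 1# s'') (line-finite (unit t s') 0# s''))
      (solve 2 (λ a x → (a :+ con (+ 1) :* x) :- (a :+ con (+ 0) :* x) := x) refl (off (unit t s') s'') _))

  ζForm-value : ∀ T → ⟪ ζForm ⟫ (vec T) ≡ (columnValue T e₀ ∞ ⊕ columnValue T e₁ ∞) ⊕ ⊝ columnValue T e₀₁ ∞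
  ζForm-value T = cong₂ (λ a b → a ⊕ ⊝ b) (cong₂ _⊕_ (vec-column T _ _) (vec-column T _ _)) (vec-column T _ _)

  ζForm-additive : ∀ T → columnValue T e₀₁ ∞ ≡ columnValue T e₀ ∞ ⊕ columnValue T e₁ ∞ → ⟪ ζForm ⟫ (vec T) ≡ 0#
  ζForm-additive T additive = trans (ζForm-value T)
    (trans (cong (λ z → (columnValue T e₀ ∞ ⊕ columnValue T e₁ ∞) ⊕ ⊝ z) additive) (-‿inverseʳ _))

  ζForm-ζ : ⟪ ζForm ⟫ (vec ζ) ≡ 1#
  ζForm-ζ = trans (ζForm-value ζ) (solve 1 (λ o → (o :+ o) :- o := o) refl 1#)

  ζForm-ξ : ∀ s' → ⟪ ζForm ⟫ (vec (ξ s')) ≡ 0#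
  ζForm-ξ s' = ζForm-additive (ξ s') (point-e₀₁ s')

  ζForm-η : ∀ s' → ⟪ ζForm ⟫ (vec (η s')) ≡ 0#
  ζForm-η s' = ζForm-additive (η s') (trans (line-∞ e₀₁ s')
    (trans (point-e₀₁ s') (sym (cong₂ _⊕_ (line-∞ e₀ s') (line-∞ e₁ s')))))

  ζForm-μ : ∀ r → ⟪ ζForm ⟫ (vec (μ r)) ≡ 0#
  ζForm-μ r = ζForm-additive (μ r) (sym (+-identityʳ 0#))

  ξForm-value : ∀ s' T → ⟪ ξForm s' ⟫ (vec T) ≡ (columnValue T (unit t s') ∞ ⊕ ⊝ ⟪ ηForm s' ⟫ (vec T)) ⊕ ⊝ ⟪ ζForm ⟫ (vec T)
  ξForm-value s' T = cong (λ a → (a ⊕ ⊝ ⟪ ηForm s' ⟫ (vec T)) ⊕ ⊝ ⟪ ζForm ⟫ (vec T)) (vec-column T _ _)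

  ξForm-from : ∀ s' T {a b c} → columnValue T (unit t s') ∞ ≡ a → ⟪ ηForm s' ⟫ (vec T) ≡ b → ⟪ ζForm ⟫ (vec T) ≡ c →
               ⟪ ξForm s' ⟫ (vec T) ≡ (a ⊕ ⊝ b) ⊕ ⊝ c
  ξForm-from s' T refl refl refl = ξForm-value s' T

  ξForm-ξ : ∀ s' s'' → ⟪ ξForm s' ⟫ (vec (ξ s'')) ≡ point t (unit t s') s''
  ξForm-ξ s' s'' = trans (ξForm-from s' (ξ s'') refl (ηForm-constant s' (ξ s'') (λ _ _ _ → refl)) (ζForm-ξ s''))
    (solve 1 (λ x → (x :- con (+ 0)) :- con (+ 0) := x) refl _)

  ξForm-η : ∀ s' s'' → ⟪ ξForm s' ⟫ (vec (η s'')) ≡ 0#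
  ξForm-η s' s'' = trans (ξForm-from s' (η s'') (line-∞ (unit t s') s'') (ηForm-η s' s'') (ζForm-η s''))
    (solve 1 (λ x → (x :- x) :- con (+ 0) := con (+ 0)) refl _)

  ξForm-ζ : ∀ s' → ⟪ ξForm s' ⟫ (vec ζ) ≡ 0#
  ξForm-ζ s' = trans (ξForm-from s' ζ refl (ηForm-constant s' ζ (λ _ _ _ → refl)) ζForm-ζ)
    (solve 1 (λ o → (o :- con (+ 0)) :- o := con (+ 0)) refl 1#)

  ξForm-μ : ∀ s' r → ⟪ ξForm s' ⟫ (vec (μ r)) ≡ 0#
  ξForm-μ s' r = trans (ξForm-from s' (μ r) refl (ηForm-constant s' (μ r) (λ _ _ _ → refl)) (ζForm-μ r))
    (solve 0 ((con (+ 0) :- con (+ 0)) :- con (+ 0) := con (+ 0)) refl)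

  dual-same : ∀ T → ⟪ dual T ⟫ (vec T) ≡ 1#
  dual-same (μ r)  = trans (vec-extra (μ r) r) (δ-same r)
  dual-same (ξ s') = trans (ξForm-ξ s' s') (point-unit-same t s')
  dual-same (η s') = trans (ηForm-η s' s') (point-unit-same t s')
  dual-same ζ      = ζForm-ζ

  dual-diff : ∀ T T' → T' ≢ T → ⟪ dual T ⟫ (vec T') ≡ 0#
  dual-diff (μ r)  (μ r')   T'≢T = trans (vec-extra (μ r') r) (δ-diff r' r (λ r≡r' → T'≢T (cong μ (sym r≡r'))))
  dual-diff (μ r)  (ξ s'')  _    = vec-extra (ξ s'') r
  dual-diff (μ r)  (η s'')  _    = vec-extra (η s'') r
  dual-diff (μ r)  ζ        _    = vec-extra ζ r
  dual-diff (ξ s') (μ r)    _    = ξForm-μ s' r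
  dual-diff (ξ s') (ξ s'')  T'≢T = trans (ξForm-ξ s' s'') (point-unit-diff t s' s'' (T'≢T ∘ cong ξ))
  dual-diff (ξ s') (η s'')  _    = ξForm-η s' s''
  dual-diff (ξ s') ζ        _    = ξForm-ζ s'
  dual-diff (η s') (μ r)    _    = ηForm-constant s' (μ r) (λ _ _ _ → refl)
  dual-diff (η s') (ξ s'')  _    = ηForm-constant s' (ξ s'') (λ _ _ _ → refl)
  dual-diff (η s') (η s'')  T'≢T = trans (ηForm-η s' s'') (point-unit-diff t s' s'' (T'≢T ∘ cong η))
  dual-diff (η s') ζ        _    = ηForm-constant s' ζ (λ _ _ _ → refl)
  dual-diff ζ      (μ r)    _    = ζForm-μ r
  dual-diff ζ      (ξ s'')  _    = ζForm-ξ s''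
  dual-diff ζ      (η s'')  _    = ζForm-η s''
  dual-diff ζ      ζ        T'≢T = ⊥-elim (T'≢T refl)

  dual-lc-absent : ∀ r (τ : Fin r → Tag) T → (∀ j → τ j ≢ T) → ∀ c → ⟪ dual T ⟫ (lc r c (vec ∘ τ)) ≡ 0#
  dual-lc-absent r τ T T∉τ c = trans (form-lc (dual T) r c (vec ∘ τ))
    (∑-zero _ (λ j → trans (cong (c j ⊛_) (dual-diff T (τ j) (T∉τ j))) (zeroʳ _)))

  dual-lc : ∀ r (τ : Fin r → Tag) → Injective _≡_ _≡_ τ → ∀ c i → ⟪ dual (τ i) ⟫ (lc r c (vec ∘ τ)) ≡ c i
  dual-lc r τ τ-injective c i = begin
    ⟪ dual (τ i) ⟫ (lc r c (vec ∘ τ))             ≡⟨ form-lc (dual (τ i)) r c (vec ∘ τ) ⟩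
    sum (λ j → c j ⊛ ⟪ dual (τ i) ⟫ (vec (τ j)))   ≡⟨ ∑-single i _ (λ j j≢i → trans (cong (c j ⊛_) (dual-diff (τ i) (τ j) (j≢i ∘ τ-injective))) (zeroʳ _)) ⟩
    c i ⊛ ⟪ dual (τ i) ⟫ (vec (τ i))              ≡⟨ trans (cong (c i ⊛_) (dual-same (τ i))) (*-identityʳ _) ⟩
    c i                                           ∎
    where open ≡-Reasoning

  tags-independent : ∀ r (τ : Fin r → Tag) → Injective _≡_ _≡_ τ → LinIndep r (vec ∘ τ)
  tags-independent r τ τ-injective c c≡0 i =
    trans (sym (dual-lc r τ τ-injective c i)) (trans (form-resp-≋ (dual (τ i)) c≡0) (form-0 (dual (τ i))))

  coordinate-cases : ∀ x → (Σ (Fin P) λ p → Σ (Fin (q + 1)) λ j → column p j ≡ x) ⊎ (Σ (Fin m) λ r → extra r ≡ x)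
  coordinate-cases x with splitAt N x in eq
  ... | inj₁ y = inj₁ (proj₁ (remQuot {P} (q + 1) y) , proj₂ (remQuot {P} (q + 1) y) ,
                       trans (cong (_↑ˡ m) (Fin.combine-remQuot {P} (q + 1) y))
                             (trans (cong (Fin.join N m) (sym eq)) (Fin.join-splitAt N m x)))
  ... | inj₂ r = inj₂ (r , trans (cong (Fin.join N m) (sym eq)) (Fin.join-splitAt N m x))

  -- Replacing one generator by a tag absent from the original family drops the
  -- dimension of the intersection by exactly one, as the dual form of the removed
  -- tag vanishes on the new span.
  swap-intersection-dim : ∀ r (τ τ' : Fin (suc r) → Tag) (i₀ : Fin (suc r)) → Injective _≡_ _≡_ τ →
    (∀ i → i ≢ i₀ → τ i ≡ τ' i) → (∀ i → τ' i ≢ τ i₀) →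
    HasDim (InSpan (suc r) (vec ∘ τ) ∩ InSpan (suc r) (vec ∘ τ')) r
  swap-intersection-dim r τ τ' i₀ τ-injective agree τᵢ₀∉τ' =
    vec ∘ τ ∘ punchIn i₀ ,
    tags-independent r (τ ∘ punchIn i₀) (Fin.punchIn-injective i₀ _ _ ∘ τ-injective) ,
    λ v → to , from
    where
    to : ∀ {v} → (InSpan (suc r) (vec ∘ τ) ∩ InSpan (suc r) (vec ∘ τ')) v → InSpan r (vec ∘ τ ∘ punchIn i₀) v
    to {v} ((c , v≋) , (c' , v≋')) = c ∘ punchIn i₀ , λ x → trans (v≋ x) (lc-drop r i₀ c (vec ∘ τ) cᵢ₀≡0 x)
      where
      cᵢ₀≡0 : c i₀ ≡ 0#
      cᵢ₀≡0 = begin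
        c i₀                                          ≡⟨ dual-lc (suc r) τ τ-injective c i₀ ⟨
        ⟪ dual (τ i₀) ⟫ (lc (suc r) c (vec ∘ τ))      ≡⟨ form-resp-≋ (dual (τ i₀)) v≋ ⟨
        ⟪ dual (τ i₀) ⟫ v                             ≡⟨ form-resp-≋ (dual (τ i₀)) v≋' ⟩
        ⟪ dual (τ i₀) ⟫ (lc (suc r) c' (vec ∘ τ'))    ≡⟨ dual-lc-absent (suc r) τ' (τ i₀) τᵢ₀∉τ' c' ⟩
        0#                                            ∎
        where open ≡-Reasoning
    from : ∀ {v} → InSpan r (vec ∘ τ ∘ punchIn i₀) v → (InSpan (suc r) (vec ∘ τ) ∩ InSpan (suc r) (vec ∘ τ')) v
    from (d , v≋) =
      (insertAt d i₀ 0# , λ x → trans (v≋ x) (sym (lc-insert-zero r i₀ d (vec ∘ τ) x))) ,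
      (insertAt d i₀ 0# , λ x → trans (v≋ x) (trans (lc≡∑ r d _ x) (trans (sum-cong-≗ (same x))
                               (trans (sym (lc≡∑ r d _ x)) (sym (lc-insert-zero r i₀ d (vec ∘ τ') x))))))
      where
      same : ∀ x j → d j ⊛ vec (τ (punchIn i₀ j)) x ≡ d j ⊛ vec (τ' (punchIn i₀ j)) x
      same x j = cong (λ T → d j ⊛ vec T x) (agree (punchIn i₀ j) (Fin.punchInᵢ≢i i₀ j))

  -- A code of the construction is spanned by one tag for every slot s' < t
  -- together with all μ r; the tag of slot s' is ξ s', η s' or (for s' = 0) ζ.
  slot : Tag → Fin t
  slot (ξ s') = s'
  slot (η s') = s'
  slot ζ      = zero
  slot (μ _)  = zero

  record Valid (σ : Fin t → Tag) : Set where
    field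
      slot-σ : ∀ s' → slot (σ s') ≡ s'
      σ≢μ    : ∀ s' r → σ s' ≢ μ r

  family : (Fin t → Tag) → Fin k → Tag
  family σ = σ ++ μ

  family-↑ˡ : ∀ σ s' → family σ (s' ↑ˡ m) ≡ σ s'
  family-↑ˡ σ s' = cong [ σ , μ ]′ (Fin.splitAt-↑ˡ t s' m)

  family-↑ʳ : ∀ σ r → family σ (t ↑ʳ r) ≡ μ r
  family-↑ʳ σ r = cong [ σ , μ ]′ (Fin.splitAt-↑ʳ t m r)

  μ-injective : ∀ {r r'} → μ r ≡ μ r' → r ≡ r'
  μ-injective refl = refl

  family-injective : ∀ σ → Valid σ → Injective _≡_ _≡_ (family σ)
  family-injective σ valid {i} {j} eq =
    trans (sym (Fin.join-splitAt t m i)) (trans (cong (Fin.join t m) (split-injective (splitAt t i) (splitAt t j) eq)) (Fin.join-splitAt t m j))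
    where
    open Valid valid
    split-injective : ∀ (a b : Fin t ⊎ Fin m) → [ σ , μ ]′ a ≡ [ σ , μ ]′ b → a ≡ b
    split-injective (inj₁ x) (inj₁ y) e = cong inj₁ (trans (sym (slot-σ x)) (trans (cong slot e) (slot-σ y)))
    split-injective (inj₁ x) (inj₂ y) e = ⊥-elim (σ≢μ x y e)
    split-injective (inj₂ x) (inj₁ y) e = ⊥-elim (σ≢μ y x (sym e))
    split-injective (inj₂ x) (inj₂ y) e = cong inj₂ (μ-injective e)

  Code : (Fin t → Tag) → Sub
  Code σ = InSpan k (vec ∘ family σ)

  Code-dim : ∀ σ → Valid σ → HasDim (Code σ) k
  Code-dim σ valid = vec ∘ family σ , tags-independent k (family σ) (family-injective σ valid) , λ v → (λ v∈ → v∈) , (λ v∈ → v∈)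

  slot∈Code : ∀ σ s' → Code σ (vec (σ s'))
  slot∈Code σ s' = span-resp-≋ k (vec ∘ family σ) (λ x → cong (λ T → vec T x) (family-↑ˡ σ s')) (span-generator k (vec ∘ family σ) (s' ↑ˡ m))

  μ∈Code : ∀ σ r → Code σ (vec (μ r))
  μ∈Code σ r = span-resp-≋ k (vec ∘ family σ) (λ x → cong (λ T → vec T x) (family-↑ʳ σ r)) (span-generator k (vec ∘ family σ) (t ↑ʳ r))

  Code-isCode : ∀ σ → Valid σ → (∀ p j → Σ (Fin t) λ s' → columnValue (σ s') p j ≢ 0#) → IsCode k (Code σ)
  Code-isCode σ valid column≢0 = Code-dim σ valid , nondegenerate
    where
    nondegenerate : ∀ x → ¬ ⊆C (Code σ) x
    nondegenerate x Code⊆Cₓ with coordinate-cases x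
    ... | inj₁ (p , j , refl) = proj₂ (column≢0 p j)
            (trans (sym (vec-column (σ (proj₁ (column≢0 p j))) p j)) (Code⊆Cₓ _ (slot∈Code σ _)))
    ... | inj₂ (r , refl) = 1≢0 (trans (sym (δ-same r)) (trans (sym (vec-extra (μ r) r)) (Code⊆Cₓ _ (μ∈Code σ r))))

  line-nonzero : ∀ p j → Σ (Fin t) λ s' → line p j s' ≢ 0#
  line-nonzero p j with splitAt q j
  ... | inj₂ _ = point-nonzero t p
  ... | inj₁ c = on-line p
    where
    1+0≢0 : ∀ {x} → x ≡ 0# → 1# ⊕ x ≢ 0#
    1+0≢0 x≡0 e = 1≢0 (trans (sym (trans (cong (1# ⊕_) x≡0) (+-identityʳ _))) e)
    on-line : ∀ p → Σ (Fin t) λ s' → off p s' ⊕ fromFin c ⊛ point t p s' ≢ 0#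
    on-line zero = suc zero , 1+0≢0 (zeroʳ _)
    on-line (suc i) with fromFin c ≟ 0#
    ... | yes c≡0 = zero , 1+0≢0 (trans (cong (_⊛ point t (suc i) zero) c≡0) (zeroˡ _))
    ... | no c≢0 = suc (proj₁ tail≢0) , λ e → *-nonzero c≢0 (proj₂ tail≢0) (trans (sym (+-identityˡ _)) e)
      where tail≢0 = point-nonzero (suc s) (proj₂ (remQuot {q} ([ suc s ] q) i))

  X Y : Sub
  X = Code ξ
  Y = Code η

  X-valid : Valid ξ
  X-valid = record { slot-σ = λ _ → refl ; σ≢μ = λ _ _ () }

  Y-valid : Valid η
  Y-valid = record { slot-σ = λ _ → refl ; σ≢μ = λ _ _ () }

  X-dim : HasDim X k
  X-dim = Code-dim ξ X-valid

  Y-dim : HasDim Y k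
  Y-dim = Code-dim η Y-valid

  X-isCode : IsCode k X
  X-isCode = Code-isCode ξ X-valid (λ p j → point-nonzero t p)

  Y-isCode : IsCode k Y
  Y-isCode = Code-isCode η Y-valid line-nonzero

  -- The intermediate codes of a shortest walk from X to Y.
  mixed : ℕ → Fin t → Tag
  mixed j zero = ζ
  mixed j (suc s') with toℕ s' ℕ.<? j
  ... | yes _ = η (suc s')
  ... | no _  = ξ (suc s')

  mixed-η : ∀ j s' → toℕ s' < j → mixed j (suc s') ≡ η (suc s')
  mixed-η j s' s'<j with toℕ s' ℕ.<? j
  ... | yes _ = refl
  ... | no s'≮j = ⊥-elim (s'≮j s'<j)

  mixed-ξ : ∀ j s' → ¬ toℕ s' < j → mixed j (suc s') ≡ ξ (suc s')
  mixed-ξ j s' s'≮j with toℕ s' ℕ.<? j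
  ... | yes s'<j = ⊥-elim (s'≮j s'<j)
  ... | no _ = refl

  mixed-valid : ∀ j → Valid (mixed j)
  mixed-valid j = record { slot-σ = slot-mixed ; σ≢μ = mixed≢μ }
    where
    slot-mixed : ∀ s' → slot (mixed j s') ≡ s'
    slot-mixed zero = refl
    slot-mixed (suc s') with toℕ s' ℕ.<? j
    ... | yes _ = refl
    ... | no _  = refl
    mixed≢μ : ∀ s' r → mixed j s' ≢ μ r
    mixed≢μ zero r ()
    mixed≢μ (suc s') r with toℕ s' ℕ.<? j
    ... | yes _ = λ ()
    ... | no _  = λ ()

  mixed-isCode : ∀ j → IsCode k (Code (mixed j))
  mixed-isCode j = Code-isCode (mixed j) (mixed-valid j) (λ p j' → zero , 1≢0)

  adjacent-if-one-slot-differs : ∀ σ σ' s₀ → Valid σ → Valid σ' →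
    (∀ s' → s' ≢ s₀ → σ s' ≡ σ' s') → σ' s₀ ≢ σ s₀ → Adj k (Code σ) (Code σ')
  adjacent-if-one-slot-differs σ σ' s₀ σ-valid σ'-valid agree differ =
    swap-intersection-dim (suc (s + m)) (family σ) (family σ') (s₀ ↑ˡ m) (family-injective σ σ-valid) family-agree new
    where
    family-agree : ∀ i → i ≢ s₀ ↑ˡ m → family σ i ≡ family σ' i
    family-agree i i≢s₀ with splitAt t i in eq
    ... | inj₂ r  = refl
    ... | inj₁ s' = agree s' λ s'≡s₀ →
      i≢s₀ (trans (sym (Fin.join-splitAt t m i)) (trans (cong (Fin.join t m) eq) (cong (_↑ˡ m) s'≡s₀)))
    new : ∀ i → family σ' i ≢ family σ (s₀ ↑ˡ m)
    new i e with splitAt t i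
    ... | inj₂ r  = Valid.σ≢μ σ-valid s₀ r (sym (trans e (family-↑ˡ σ s₀)))
    ... | inj₁ s' = differ (trans (cong σ' s₀≡s') (trans e (family-↑ˡ σ s₀)))
      where
      s₀≡s' : s₀ ≡ s'
      s₀≡s' = trans (sym (Valid.slot-σ σ-valid s₀))
                (trans (sym (cong slot (trans e (family-↑ˡ σ s₀)))) (Valid.slot-σ σ'-valid s'))

  X~mixed₀ : Adj k X (Code (mixed 0))
  X~mixed₀ = adjacent-if-one-slot-differs ξ (mixed 0) zero X-valid (mixed-valid 0) agree (λ ())
    where
    agree : ∀ s' → s' ≢ zero → ξ s' ≡ mixed 0 s'
    agree zero s'≢0 = ⊥-elim (s'≢0 refl)
    agree (suc s') _ = sym (mixed-ξ 0 s' λ ())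

  mixed~mixed : ∀ j (s₁ : Fin (suc s)) → toℕ s₁ ≡ j → Adj k (Code (mixed j)) (Code (mixed (suc j)))
  mixed~mixed j s₁ s₁≡j = adjacent-if-one-slot-differs (mixed j) (mixed (suc j)) (suc s₁) (mixed-valid _) (mixed-valid _) agree differ
    where
    agree : ∀ s' → s' ≢ suc s₁ → mixed j s' ≡ mixed (suc j) s'
    agree zero _ = refl
    agree (suc s') s'≢s₁ = by-cases (toℕ s' ℕ.<? j)
      where
      by-cases : Dec (toℕ s' < j) → mixed j (suc s') ≡ mixed (suc j) (suc s')
      by-cases (yes s'<j) = trans (mixed-η j s' s'<j) (sym (mixed-η (suc j) s' (ℕ.m<n⇒m<1+n s'<j)))
      by-cases (no s'≮j)  = trans (mixed-ξ j s' s'≮j) (sym (mixed-ξ (suc j) s' s'≮1+j))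
        where
        s'≮1+j : ¬ toℕ s' < suc j
        s'≮1+j s'<1+j with ℕ.m≤n⇒m<n∨m≡n (ℕ.≤-pred s'<1+j)
        ... | inj₁ s'<j = s'≮j s'<j
        ... | inj₂ s'≡j = s'≢s₁ (cong suc (Fin.toℕ-injective (trans s'≡j (sym s₁≡j))))
    differ : mixed (suc j) (suc s₁) ≢ mixed j (suc s₁)
    differ e with trans (sym (mixed-η (suc j) s₁ (s≤s (ℕ.≤-reflexive s₁≡j)))) (trans e (mixed-ξ j s₁ (ℕ.<-irrefl s₁≡j)))
    ... | ()

  mixedₛ₊₁~Y : Adj k (Code (mixed (suc s))) Y
  mixedₛ₊₁~Y = adjacent-if-one-slot-differs (mixed (suc s)) η zero (mixed-valid _) Y-valid agree (λ ())
    where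
    agree : ∀ s' → s' ≢ zero → mixed (suc s) s' ≡ η s'
    agree zero s'≢0 = ⊥-elim (s'≢0 refl)
    agree (suc s') _ = mixed-η (suc s) s' (Fin.toℕ<n s')

  walk-from-mixed : ∀ d j → j + d ≡ suc s → Walk k (suc d) (Code (mixed j)) Y
  walk-from-mixed zero j j≡s+1 = Y , Y-isCode , subst (λ j → Adj k (Code (mixed j)) Y) (sym (trans (sym (ℕ.+-identityʳ j)) j≡s+1)) mixedₛ₊₁~Y ,
                                 Level.lift (λ v → (λ v∈ → v∈) , (λ v∈ → v∈))
  walk-from-mixed (suc d) j j+d+1≡s+1 = Code (mixed (suc j)) , mixed-isCode (suc j) ,
    mixed~mixed j (Fin.fromℕ< j<s+1) (Fin.toℕ-fromℕ< j<s+1) , walk-from-mixed d (suc j) (trans (sym (ℕ.+-suc j d)) j+d+1≡s+1)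
    where
    j<s+1 : j < suc s
    j<s+1 = subst (j <_) j+d+1≡s+1 (ℕ.m<m+n j (s≤s z≤n))

  walk-X-Y : Walk k (suc t) X Y
  walk-X-Y = Code (mixed 0) , mixed-isCode 0 , X~mixed₀ , walk-from-mixed (suc s) 0 refl

  μs : Fin m → Vec
  μs = vec ∘ μ

  lc-family : ∀ σ c x → lc k c (vec ∘ family σ) x ≡
              sum (λ s' → c (s' ↑ˡ m) ⊛ vec (σ s') x) ⊕ sum (λ r → c (t ↑ʳ r) ⊛ μs r x)
  lc-family σ c x = trans (lc≡∑ k c (vec ∘ family σ) x) (trans (∑-++ t m (λ i → c i ⊛ vec (family σ i) x))
    (cong₂ _⊕_ (sum-cong-≗ (λ s' → cong (λ T → c (s' ↑ˡ m) ⊛ vec T x) (family-↑ˡ σ s')))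
               (sum-cong-≗ (λ r → cong (λ T → c (t ↑ʳ r) ⊛ vec T x) (family-↑ʳ σ r)))))

  X∩Y⊆μ : ∀ {v} → (X ∩ Y) v → InSpan m μs v
  X∩Y⊆μ {v} ((c , v≋) , (c' , v≋')) = c ∘ (t ↑ʳ_) , λ x → begin
    v x                                                                  ≡⟨ trans (v≋ x) (lc-family ξ c x) ⟩
    sum (λ s' → c (s' ↑ˡ m) ⊛ vec (ξ s') x) ⊕ sum (λ r → c (t ↑ʳ r) ⊛ μs r x)
      ≡⟨ cong (_⊕ sum (λ r → c (t ↑ʳ r) ⊛ μs r x)) (∑-zero _ (λ s' → trans (cong (_⊛ vec (ξ s') x) (ξ-coefficient≡0 s')) (zeroˡ _))) ⟩
    0# ⊕ sum (λ r → c (t ↑ʳ r) ⊛ μs r x)                                 ≡⟨ +-identityˡ _ ⟩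
    sum (λ r → c (t ↑ʳ r) ⊛ μs r x)                                      ≡⟨ lc≡∑ m _ μs x ⟨
    lc m (c ∘ (t ↑ʳ_)) μs x                                              ∎
    where
    open ≡-Reasoning
    ξ∉Y : ∀ s' i → family η i ≢ ξ s'
    ξ∉Y s' i with splitAt t i
    ... | inj₁ _ = λ ()
    ... | inj₂ _ = λ ()
    ξ-coefficient≡0 : ∀ s' → c (s' ↑ˡ m) ≡ 0#
    ξ-coefficient≡0 s' = begin
      c (s' ↑ˡ m)                                        ≡⟨ dual-lc k (family ξ) (family-injective ξ X-valid) c (s' ↑ˡ m) ⟨
      ⟪ dual (family ξ (s' ↑ˡ m)) ⟫ (lc k c (vec ∘ family ξ)) ≡⟨ cong (λ T → ⟪ dual T ⟫ (lc k c (vec ∘ family ξ))) (family-↑ˡ ξ s') ⟩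
      ⟪ ξForm s' ⟫ (lc k c (vec ∘ family ξ))             ≡⟨ form-resp-≋ (ξForm s') v≋ ⟨
      ⟪ ξForm s' ⟫ v                                     ≡⟨ form-resp-≋ (ξForm s') v≋' ⟩
      ⟪ ξForm s' ⟫ (lc k c' (vec ∘ family η))            ≡⟨ dual-lc-absent k (family η) (ξ s') (ξ∉Y s') c' ⟩
      0#                                                 ∎

  X∩Y-dim : HasDim (X ∩ Y) m
  X∩Y-dim = μs , tags-independent m μ μ-injective ,
            λ v → X∩Y⊆μ , λ v∈ → span⊆ X-dim μs (μ∈Code ξ) v∈ , span⊆ Y-dim μs (μ∈Code η) v∈

  no-short-walk : ∀ ℓ → ℓ < t → ¬ Walk k ℓ X Y
  no-short-walk ℓ ℓ<t walk with walk⇒common-independent (suc (s + m)) ℓ X-dim Y-dim walk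
  ... | u , u-indep , u∈X , u∈Y =
    ℕ.<⇒≱ m<k∸ℓ (independent-in-span⇒≤ (k ∸ ℓ) m u μs u-indep (λ i → X∩Y⊆μ (u∈X i , u∈Y i)))
    where
    m<k∸ℓ : m < k ∸ ℓ
    m<k∸ℓ = subst (m <_) (sym (ℕ.+-∸-comm m (ℕ.<⇒≤ ℓ<t))) (ℕ.m<n+m m (ℕ.m<n⇒0<n∸m ℓ<t))

  lc-family-column : ∀ σ c p j → lc k c (vec ∘ family σ) (column p j) ≡ sum (λ s' → c (s' ↑ˡ m) ⊛ columnValue (σ s') p j)
  lc-family-column σ c p j = trans (lc-family σ c (column p j)) (trans (cong₂ _⊕_
      (sum-cong-≗ (λ s' → cong (c (s' ↑ˡ m) ⊛_) (vec-column (σ s') p j)))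
      (∑-zero _ (λ r → trans (cong (c (t ↑ʳ r) ⊛_) (vec-column (μ r) p j)) (zeroʳ _))))
    (+-identityʳ _))

  line-meets-kernel : ∀ (d : Fin t → Carrier) p → Σ (Fin (q + 1)) λ j → sum (λ s' → d s' ⊛ line p j s') ≡ 0#
  line-meets-kernel d p with sum (λ s' → d s' ⊛ point t p s') ≟ 0#
  ... | yes D≡0 = ∞ , trans (sum-cong-≗ (λ s' → cong (d s' ⊛_) (line-∞ p s'))) D≡0
  ... | no D≢0 = finite c , (begin
    sum (λ s' → d s' ⊛ line p (finite c) s')
      ≡⟨ sum-cong-≗ (λ s' → trans (cong (d s' ⊛_) (line-finite p c s'))
                                  (solve 4 (λ d f c v → d :* (f :+ c :* v) := d :* f :+ c :* (d :* v)) refl (d s') (off p s') c (point t p s'))) ⟩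
    sum (λ s' → d s' ⊛ off p s' ⊕ c ⊛ (d s' ⊛ point t p s'))
      ≡⟨ ∑-distrib-+ (λ s' → d s' ⊛ off p s') (λ s' → c ⊛ (d s' ⊛ point t p s')) ⟩
    O ⊕ sum (λ s' → c ⊛ (d s' ⊛ point t p s'))   ≡⟨ cong (O ⊕_) (*-distribˡ-sum c (λ s' → d s' ⊛ point t p s')) ⟨
    O ⊕ c ⊛ D                                    ≡⟨ solve 3 (λ O i D → O :+ (:- (O :* i)) :* D := O :* (con (+ 1) :- i :* D)) refl O (inv D D≢0) D ⟩
    O ⊛ (1# ⊕ ⊝ (inv D D≢0 ⊛ D))                 ≡⟨ cong (λ z → O ⊛ (1# ⊕ ⊝ z)) (*-inverseˡ D D≢0) ⟩
    O ⊛ (1# ⊕ ⊝ 1#)                              ≡⟨ trans (cong (O ⊛_) (-‿inverseʳ 1#)) (zeroʳ _) ⟩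
    0#                                           ∎)
    where
    open ≡-Reasoning
    D = sum (λ s' → d s' ⊛ point t p s')
    O = sum (λ s' → d s' ⊛ off p s')
    c = ⊝ (O ⊛ inv D D≢0)

  module FirstStep (Z : Sub) (Z-dim : HasDim Z k) (X~Z : Adj k X Z) (walk : Walk k (suc s) Z Y) where
    H : Sub
    H = X ∩ Z

    H-dim : HasDim H (suc (s + m))
    H-dim = X~Z

    common : CommonIndependent Z Y (suc m)
    common = subst (CommonIndependent Z Y) k∸t-1≡m+1 (walk⇒common-independent (suc (s + m)) (suc s) Z-dim Y-dim walk)
      where
      k∸t-1≡m+1 : k ∸ suc s ≡ suc m
      k∸t-1≡m+1 = trans (cong (_∸ s) (sym (ℕ.+-suc s m))) (ℕ.m+n∸m≡n s (suc m))

    u : Fin (suc m) → Vec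
    u = proj₁ common

    u-indep : LinIndep (suc m) u
    u-indep = proj₁ (proj₂ common)

    u∈Z : ∀ i → Z (u i)
    u∈Z = proj₁ (proj₂ (proj₂ common))

    u∈Y : ∀ i → Y (u i)
    u∈Y = proj₂ (proj₂ (proj₂ common))

    -- Projecting the common family into the hyperplane H of Z gives m independent
    -- vectors of X ∩ Y = span μ, so they span it.
    μ∈H : ∀ r → H (μs r)
    μ∈H = span⊆ H-dim w w∈H ∘ independent-in-span-spans m μs w w-indep w∈μ
      where
      projected = independent-into-hyperplane (suc (s + m)) (suc m) Z-dim H-dim proj₂ u u-indep u∈Z
      w : Fin m → Vec
      w = proj₁ projected
      w-indep : LinIndep m w
      w-indep = proj₁ (proj₂ projected)
      w∈H : ∀ i → H (w i)
      w∈H = proj₁ (proj₂ (proj₂ projected))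
      w∈μ : ∀ i → InSpan m μs (w i)
      w∈μ i = X∩Y⊆μ (proj₁ (w∈H i) , span⊆ Y-dim u u∈Y (proj₂ (proj₂ (proj₂ projected)) i))

    outside-X : Σ Vec λ y → Z y × Y y × ¬ X y
    outside-X = outside (Fin.all? (λ i → InSpan? k (vec ∘ family ξ) (u i)))
      where
      outside : Dec (∀ i → X (u i)) → Σ Vec λ y → Z y × Y y × ¬ X y
      outside (yes all∈X) = ⊥-elim (ℕ.n≮n m (independent-in-span⇒≤ (suc m) m u μs u-indep (λ i → X∩Y⊆μ (all∈X i , u∈Y i))))
      outside (no ¬all∈X) = u i , u∈Z i , u∈Y i , uᵢ∉X
        where
        witness = Fin.¬∀⟶∃¬ (suc m) _ (λ i → InSpan? k (vec ∘ family ξ) (u i)) ¬all∈X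
        i = proj₁ witness
        uᵢ∉X = proj₂ witness

    complement : Complement X H
    complement = hyperplane-complement (suc (s + m)) X-dim H-dim proj₁

    open Complement complement

    h : Fin t → Vec
    h s' = proj₁ (split (slot∈Code ξ s'))

    a : Fin t → Carrier
    a s' = proj₁ (proj₂ (split (slot∈Code ξ s')))

    h∈H : ∀ s' → H (h s')
    h∈H s' = proj₁ (proj₂ (proj₂ (split (slot∈Code ξ s'))))

    ξ≋ : ∀ s' → vec (ξ s') ≋ (h s' +v (a s' ·v z₀))
    ξ≋ s' = proj₂ (proj₂ (proj₂ (split (slot∈Code ξ s'))))

    a≢0 : Σ (Fin t) λ s' → a s' ≢ 0#
    a≢0 = nonzero (zero-or-nonzero a)
      where
      nonzero : (∀ s' → a s' ≡ 0#) ⊎ Σ (Fin t) (λ s' → a s' ≢ 0#) → Σ (Fin t) λ s' → a s' ≢ 0#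
      nonzero (inj₂ a≢0) = a≢0
      nonzero (inj₁ a≡0) = ⊥-elim (z₀∉W (∈-resp-≋ H-dim (λ x → sym (proj₂ z₀∈Z x))
                             (∈-lc H-dim k (vec ∘ family ξ) (proj₁ z₀∈Z) (generator∈H ∘ splitAt t))))
        where
        generator∈H : ∀ i → H (vec ([ ξ , μ ]′ i))
        generator∈H (inj₂ r)  = μ∈H r
        generator∈H (inj₁ s') = ∈-resp-≋ H-dim (λ x → sym (trans (ξ≋ s' x)
          (trans (cong (λ α → h s' x ⊕ α ⊛ z₀ x) (a≡0 s')) (trans (cong (h s' x ⊕_) (zeroˡ _)) (+-identityʳ _))))) (h∈H s')

    p : Fin P
    p = proj₁ (proportional-to-point t a a≢0)

    λ₀ : Carrier
    λ₀ = proj₁ (proj₂ (proportional-to-point t a a≢0))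

    λ₀≢0 : λ₀ ≢ 0#
    λ₀≢0 = proj₁ (proj₂ (proj₂ (proportional-to-point t a a≢0)))

    a≡λ₀p : ∀ s' → a s' ≡ λ₀ ⊛ point t p s'
    a≡λ₀p = proj₂ (proj₂ (proj₂ (proportional-to-point t a a≢0)))

    ⟨_,a⟩ : (Fin k → Carrier) → Carrier
    ⟨ c ,a⟩ = sum (λ s' → c (s' ↑ˡ m) ⊛ a s')

    H-part : (Fin k → Carrier) → Vec
    H-part c = lc t (c ∘ (_↑ˡ m)) h +v lc m (c ∘ (t ↑ʳ_)) μs

    split-lc : ∀ c → lc k c (vec ∘ family ξ) ≋ (H-part c +v (⟨ c ,a⟩ ·v z₀))
    split-lc c x = begin
      lc k c (vec ∘ family ξ) x                               ≡⟨ lc-family ξ c x ⟩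
      sum (λ s' → cₛ s' ⊛ vec (ξ s') x) ⊕ M
        ≡⟨ cong (_⊕ M) (trans (sum-cong-≗ (λ s' → trans (cong (cₛ s' ⊛_) (ξ≋ s' x)) (distribˡ _ _ _)))
                              (∑-distrib-+ (λ s' → cₛ s' ⊛ h s' x) (λ s' → cₛ s' ⊛ (a s' ⊛ z₀ x)))) ⟩
      (Hx ⊕ sum (λ s' → cₛ s' ⊛ (a s' ⊛ z₀ x))) ⊕ M
        ≡⟨ cong (λ z → (Hx ⊕ z) ⊕ M) (trans (sum-cong-≗ (λ s' → sym (*-assoc (cₛ s') (a s') (z₀ x))))
                                             (sym (*-distribʳ-sum (z₀ x) (λ s' → cₛ s' ⊛ a s')))) ⟩
      (Hx ⊕ ⟨ c ,a⟩ ⊛ z₀ x) ⊕ M                               ≡⟨ solve 3 (λ P Q R → (P :+ Q) :+ R := (P :+ R) :+ Q) refl Hx _ M ⟩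
      (Hx ⊕ M) ⊕ ⟨ c ,a⟩ ⊛ z₀ x                               ≡⟨ cong (_⊕ ⟨ c ,a⟩ ⊛ z₀ x) (sym (cong₂ _⊕_ (lc≡∑ t cₛ h x) (lc≡∑ m _ μs x))) ⟩
      H-part c x ⊕ ⟨ c ,a⟩ ⊛ z₀ x                             ∎
      where
      open ≡-Reasoning
      cₛ : Fin t → Carrier
      cₛ s' = c (s' ↑ˡ m)
      Hx = sum (λ s' → cₛ s' ⊛ h s' x)
      M = sum (λ r → c (t ↑ʳ r) ⊛ μs r x)

    H-vanishes-on-block : ∀ {v} → H v → ∀ j → v (column p j) ≡ 0#
    H-vanishes-on-block {v} v∈H j = trans (proj₂ (proj₁ v∈H) (column p j)) (trans (lc-family-column ξ c p j)
      (*-cancelˡ-zero λ₀ (sum (λ s' → c (s' ↑ˡ m) ⊛ point t p s')) λ₀≢0 (begin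
        λ₀ ⊛ sum (λ s' → c (s' ↑ˡ m) ⊛ point t p s')    ≡⟨ *-distribˡ-sum λ₀ (λ s' → c (s' ↑ˡ m) ⊛ point t p s') ⟩
        sum (λ s' → λ₀ ⊛ (c (s' ↑ˡ m) ⊛ point t p s'))
          ≡⟨ sum-cong-≗ (λ s' → trans (solve 3 (λ l c v → l :* (c :* v) := c :* (l :* v)) refl λ₀ (c (s' ↑ˡ m)) (point t p s'))
                                      (cong (c (s' ↑ˡ m) ⊛_) (sym (a≡λ₀p s')))) ⟩
        ⟨ c ,a⟩                                          ≡⟨ complement-unique H-dim complement ⟨ c ,a⟩ v∈H H-part∈H v≋ ⟩
        0#                                               ∎)))
      where
      open ≡-Reasoning
      c = proj₁ (proj₁ v∈H)
      v≋ : v ≋ (H-part c +v (⟨ c ,a⟩ ·v z₀))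
      v≋ x = trans (proj₂ (proj₁ v∈H) x) (split-lc c x)
      H-part∈H : H (H-part c)
      H-part∈H = ∈-+ H-dim (∈-lc H-dim t h (c ∘ (_↑ˡ m)) h∈H) (∈-lc H-dim m μs (c ∘ (t ↑ʳ_)) μ∈H)

    Z-degenerate : Σ (Fin n) (⊆C Z)
    Z-degenerate = column p j , λ z z∈Z →
      hyperplane-vanishing (suc (s + m)) {Z} {H} Z-dim H-dim (λ v∈H → proj₂ v∈H) {y} y∈Z y∉H (column p j) yₚⱼ≡0
        (λ v∈H → H-vanishes-on-block v∈H j) {z} z∈Z
      where
      y : Vec
      y = proj₁ outside-X
      y∈Z : Z y
      y∈Z = proj₁ (proj₂ outside-X)
      y∈Y : Y y
      y∈Y = proj₁ (proj₂ (proj₂ outside-X))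
      y∉H : ¬ H y
      y∉H y∈H = proj₂ (proj₂ (proj₂ outside-X)) (proj₁ y∈H)
      d : Fin t → Carrier
      d s' = proj₁ y∈Y (s' ↑ˡ m)
      j : Fin (q + 1)
      j = proj₁ (line-meets-kernel d p)
      yₚⱼ≡0 : y (column p j) ≡ 0#
      yₚⱼ≡0 = trans (proj₂ y∈Y (column p j)) (trans (lc-family-column η (proj₁ y∈Y) p j) (proj₂ (line-meets-kernel d p)))

  no-walk : ∀ ℓ → ℓ < suc t → ¬ Walk k ℓ X Y
  no-walk ℓ ℓ<t+1 = [ no-short-walk ℓ , (λ { refl → no-walk-of-length-t }) ]′ (ℕ.m<1+n⇒m<n∨m≡n ℓ<t+1)
    where
    no-walk-of-length-t : ¬ Walk k t X Y
    no-walk-of-length-t (Z , (Z-dim , Z-nondegenerate) , X~Z , walk) =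
      Z-nondegenerate (proj₁ degenerate) (proj₂ degenerate)
      where degenerate = FirstStep.Z-degenerate Z Z-dim X~Z walk

CodesAtDistance : ∀ {q} → FiniteField q → (n k d : ℕ) → Set₁
CodesAtDistance F n k d = let open Space F n in
  Σ Sub λ X → Σ Sub λ Y → IsCode k X × IsCode k Y × Dist k X Y d × DistC k X Y (suc d)

construction : ∀ {q} (F : FiniteField q) s m → let t = suc (suc s) in CodesAtDistance F ([ t ] q * (q + 1) + m) (t + m) t
construction F s m = X , Y , X-isCode , Y-isCode , (m , X∩Y-dim , sym (ℕ.m+n∸n≡m t m)) , (walk-X-Y , no-walk)
  where open Construction F s m

-- Only 2 ≤ k − m is used: the remaining hypotheses delimit the range of parameters
-- considered in the paper, and F itself witnesses that q is a prime power.
lemma6 : (q : ℕ) → IsPrimePower q → (F : FiniteField q) → (n k m : ℕ) →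
    1 < k → k < n ∸ 1 → mnk n k ≤ m → m ≤ k ∸ 2 →
    n ≡ [ k ∸ m ] q * (q + 1) + m →
    let open Space F n in
    Σ Sub λ X → Σ Sub λ Y → IsCode k X × IsCode k Y ×
      Dist k X Y (k ∸ m) × DistC k X Y (suc (k ∸ m))
lemma6 q _ F .([ suc (suc k') ∸ m ] q * (q + 1) + m) (suc (suc k')) m (s≤s (s≤s _)) _ _ m≤k' refl =
  subst (λ d → CodesAtDistance F ([ d ] q * (q + 1) + m) (suc (suc k')) d) (sym (ℕ.+-∸-assoc 2 m≤k'))
    (subst (λ k → CodesAtDistance F ([ t ] q * (q + 1) + m) k t) (cong (λ x → suc (suc x)) (ℕ.m∸n+n≡m m≤k'))
      (construction F (k' ∸ m) m))
  where t = suc (suc (k' ∸ m))
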